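{- Let $H=(V,E)$ be a finite bipartite graph with no isolated vertices. If $H$ is a forest but not a star graph, and $H$ is not isomorphic to any of $H_n^1$ ($n\ge2$), $H_n^2$ ($n$ even), $H_n^3$ ($n$ even), $H_n^4$ ($n$ odd, $n\ge3$), then \[\min_{e\in E(H)}|S_1(e)|<|E(H)|-\frac{|V(H)|}{2}.\]
   Context: For an edge $e$, $S_1(e)$ is the set of edges different from $e$ sharing an endpoint with $e$. A star graph is $K_{1,m}$, $m\ge1$. $H_n^1$ is the disjoint union of $n$ edges; $H_n^2$ and $H_n^3$ ($n$ even) are each, as graphs, the disjoint union of two copies of $K_{1,n/2}$; $H_n^4$ ($n$ odd, $n\ge3$), with $k=\frac{n+1}{2}$, has vertices $u_1,\dots,u_k,v_1,\dots,v_k$ and edges $u_1v_j$ ($1\le j\le k$) and $u_iv_k$ ($1\le i\le k$). -}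

module Defs where

open import Data.Nat using (ℕ; zero; suc; _+_; _*_; _∸_; _≤_; _<_; _⊓_; _≡ᵇ_; _<ᵇ_; ⌊_/2⌋)
open import Data.Bool using (Bool; true; false; _∧_; _∨_; not; _xor_; if_then_else_)
open import Data.Fin using (Fin; toℕ; inject₁; fromℕ) renaming (zero to fzero; suc to fsuc)
open import Data.List using (List; []; _∷_; length; map; foldr; filterᵇ; cartesianProduct; allFin)
open import Data.Sum using (_⊎_)
open import Data.Product using (Σ; _×_; _,_; proj₁; proj₂; ∃; ∃-syntax)
open import Relation.Binary.PropositionalEquality using (_≡_; _≢_)
open import Relation.Nullary using (¬_)
open import Function.Definitions using (Injective)
open import Function.Bundles using (_↔_; Inverse)

record Graph (n : ℕ) : Set where
  field
    adj    : Fin n → Fin n → Bool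
    sym    : ∀ i j → adj i j ≡ adj j i
    irrefl : ∀ i → adj i i ≡ false
open Graph public

-- Edges of G: unordered pairs {i,j} encoded as (i , j) with toℕ i < toℕ j.
edges : ∀ {n} → Graph n → List (Fin n × Fin n)
edges {n} G = filterᵇ (λ p → (toℕ (proj₁ p) <ᵇ toℕ (proj₂ p)) ∧ adj G (proj₁ p) (proj₂ p))
                      (cartesianProduct (allFin n) (allFin n))

numEdges : ∀ {n} → Graph n → ℕ
numEdges G = length (edges G)

_≡F_ : ∀ {n} → Fin n → Fin n → Bool
a ≡F b = toℕ a ≡ᵇ toℕ b

sameEdge : ∀ {n} → Fin n × Fin n → Fin n × Fin n → Bool
sameEdge (a , b) (c , d) = (a ≡F c) ∧ (b ≡F d)

shareEndpoint : ∀ {n} → Fin n × Fin n → Fin n × Fin n → Bool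
shareEndpoint (a , b) (c , d) = (a ≡F c) ∨ (a ≡F d) ∨ (b ≡F c) ∨ (b ≡F d)

S1size : ∀ {n} → Graph n → Fin n × Fin n → ℕ
S1size G e = length (filterᵇ (λ e' → not (sameEdge e e') ∧ shareEndpoint e e') (edges G))

-- minimum of a list of naturals (0 on the empty list; only used on nonempty lists)
minℕ : List ℕ → ℕ
minℕ []       = 0
minℕ (x ∷ xs) = foldr _⊓_ x xs

minS1 : ∀ {n} → Graph n → ℕ
minS1 G = minℕ (map (S1size G) (edges G))

HasEdge : ∀ {n} → Graph n → Set
HasEdge {n} G = Σ (Fin n) λ i → Σ (Fin n) λ j → adj G i j ≡ true

NoIsolated : ∀ {n} → Graph n → Set
NoIsolated {n} G = ∀ (i : Fin n) → Σ (Fin n) λ j → adj G i j ≡ true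

Bipartite : ∀ {n} → Graph n → Set
Bipartite {n} G = Σ (Fin n → Bool) λ col → ∀ i j → adj G i j ≡ true → col i ≢ col j

-- A cycle of length L+1 ≥ 3: injective c : Fin (suc L) → Fin n with
-- consecutive vertices adjacent and the last adjacent to the first.
record Cycle {n} (G : Graph n) : Set where
  field
    L      : ℕ
    long   : 2 ≤ L
    c      : Fin (suc L) → Fin n
    inj    : Injective _≡_ _≡_ c
    step   : ∀ (i : Fin L) → adj G (c (inject₁ i)) (c (fsuc i)) ≡ true
    close  : adj G (c (fromℕ L)) (c fzero) ≡ true

Forest : ∀ {n} → Graph n → Set
Forest G = ¬ Cycle G

IsoTo : ∀ {n} → Graph n → (m : ℕ) → (Fin m → Fin m → Bool) → Set
IsoTo {n} G m a = Σ (Fin n ↔ Fin m) λ f →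
  ∀ i j → adj G i j ≡ a (Inverse.to f i) (Inverse.to f j)

starAdj : (m : ℕ) → Fin (suc m) → Fin (suc m) → Bool
starAdj m i j = (toℕ i ≡ᵇ 0) xor (toℕ j ≡ᵇ 0)

IsStar : ∀ {n} → Graph n → Set
IsStar G = Σ ℕ λ m → (1 ≤ m) × IsoTo G (suc m) (starAdj m)

-- H_n^1 : n disjoint edges on Fin (n + n), edges {2t, 2t+1}.
H1Adj : (n : ℕ) → Fin (n + n) → Fin (n + n) → Bool
H1Adj n i j = (⌊ toℕ i /2⌋ ≡ᵇ ⌊ toℕ j /2⌋) ∧ not (toℕ i ≡ᵇ toℕ j)

-- H_n^2 = H_n^3 (as graphs), n = 2m: two disjoint copies of K_{1,m}
-- on Fin (suc m + suc m); centres 0 and suc m.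
twoStarAdj : (m : ℕ) → Fin (suc m + suc m) → Fin (suc m + suc m) → Bool
twoStarAdj m i j =
  (side i ≡B side j) ∧ ((loc i ≡ᵇ 0) xor (loc j ≡ᵇ 0))
  where
    side : Fin (suc m + suc m) → Bool
    side x = toℕ x <ᵇ suc m
    loc : Fin (suc m + suc m) → ℕ
    loc x = if side x then toℕ x else toℕ x ∸ suc m
    _≡B_ : Bool → Bool → Bool
    a ≡B b = not (a xor b)

-- H_n^4, n = 2k - 1, k = (n+1)/2: vertices u_a = a (a < k), v_b = k + b (b < k)
-- (0-indexed), edges u_0 v_b for all b and u_a v_{k-1} for all a.
H4Adj : (k : ℕ) → Fin (k + k) → Fin (k + k) → Bool
H4Adj k i j = e i j ∨ e j i
  where
    e : Fin (k + k) → Fin (k + k) → Bool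
    e x y = (toℕ x <ᵇ k) ∧ not (toℕ y <ᵇ k)
            ∧ ((toℕ x ≡ᵇ 0) ∨ (toℕ y ≡ᵇ (k + k) ∸ 1))

Exceptional : ∀ {n} → Graph n → Set
Exceptional G =
    (Σ ℕ λ t → (2 ≤ t) × IsoTo G (t + t) (H1Adj t))
  ⊎ ((Σ ℕ λ m → (1 ≤ m) × IsoTo G (suc m + suc m) (twoStarAdj m))
  ⊎ (Σ ℕ λ k → (2 ≤ k) × IsoTo G (k + k) (H4Adj k)))

{-# OPTIONS --safe #-}
-- Let excess w = deg w − 1 and F = Σ excess = 2|E| − |V|. Since |S₁(uv)| ≤ excess u + excess v, if the
-- inequality fails then every edge uv is heavy: F ≤ 2 (excess u + excess v).
-- Two disjoint heavy edges each carry exactly F/2, so every other vertex is a leaf. If F = 0 the graph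
-- is a perfect matching, H¹. Otherwise no edge joins two leaves, each of the two edges has just one
-- non-leaf end (a second one would close a triangle or a 4-cycle), and the graph is a double star
-- whose centres have equal degree: H⁴ if the centres are adjacent, H² = H³ if not.
-- If instead every edge meets a fixed edge uv, the graph is a star or, by the same balancing, H⁴.
module Submission where

open import Defs hiding (sym)

open import Data.Bool using (T; Bool; true; false; _∧_; _∨_; not; if_then_else_; _xor_)
open import Data.Bool.Properties using (∧-zeroʳ; ∧-identityʳ; ¬-not; not-¬; not-involutive; not-injective)
  renaming (_≟_ to _≟ᵇ_)
open import Data.Empty using (⊥; ⊥-elim)
open import Data.Fin using (Fin; toℕ; fromℕ<; punchOut; inject₁) renaming (zero to fzero; suc to fsuc)
open import Data.Fin.Permutation using (Permutation; permutation)
open import Data.Fin.Properties using (toℕ-injective; toℕ-fromℕ<; punchOut-injective; injective⇒≤; any?)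
  renaming (_≟_ to _≟ᶠ_)
open import Data.List as List using (List; []; _∷_; length; map; filterᵇ; cartesianProduct; allFin; _++_)
open import Data.List.Membership.Propositional using (_∈_)
open import Data.List.Membership.Propositional.Properties
  using (∈-filter⁺; ∈-cartesianProduct⁺; ∈-allFin; ∈-map⁺; ∈-lookup)
open import Data.List.Properties using (map-++; map-∘)
open import Data.List.Relation.Unary.All as All using (All; []; _∷_)
open import Data.List.Relation.Unary.Any using (here; there)
open import Data.List.Relation.Unary.Unique.Propositional using (Unique; []; _∷_)
open import Data.Nat using (ℕ; zero; suc; _+_; _*_; _∸_; _≤_; _<_; z≤n; s≤s; s≤s⁻¹; _≡ᵇ_; _<ᵇ_; _⊓_; ⌊_/2⌋)
import Data.Nat.ListAction as ℕ
open import Data.Nat.ListAction.Properties using (sum-++)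
open import Data.Nat.Properties
open import Algebra.Properties.CommutativeMonoid.Sum +-0-commutativeMonoid
  using (sum; sum-syntax; ∑-distrib-+; ∑-comm; ∑-permute; sum-cong-≗; sum-replicate-zero)
open import Algebra.Properties.CommutativeSemigroup +-commutativeSemigroup using (x∙yz≈y∙xz)
open import Data.Nat.Tactic.RingSolver using (solve-∀)
open import Data.Product using (Σ; _×_; _,_; proj₁; proj₂)
open import Data.Product.Properties using (≡-dec)
open import Data.Sum as Sum using (_⊎_; inj₁; inj₂; [_,_]; swap)
open import Function using (_∘_; id)
open import Function.Bundles using (mk↔ₛ′)
open import Function.Definitions using (Injective)
open import Relation.Binary.Definitions using (DecidableEquality; tri<; tri≈; tri>)
open import Relation.Binary.PropositionalEquality
  using (_≡_; _≢_; refl; sym; trans; cong; cong₂; subst; ≢-sym; module ≡-Reasoning)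
open import Relation.Nullary using (¬_; Dec; yes; no; does)
open import Relation.Nullary.Decidable using (dec-true; dec-false; T?; ¬?; _×-dec_; _⊎-dec_; decidable-stable)

𝟙 : Bool → ℕ
𝟙 true  = 1
𝟙 false = 0

𝟙-if : ∀ b → 𝟙 b ≡ (if b then 1 else 0)
𝟙-if true  = refl
𝟙-if false = refl

<ᵇ-true : ∀ {m n} → m < n → (m <ᵇ n) ≡ true
<ᵇ-true {m} {n} = dec-true (m <? n)

<ᵇ-false : ∀ {m n} → ¬ m < n → (m <ᵇ n) ≡ false
<ᵇ-false {m} {n} = dec-false (m <? n)

≡ᵇ-true : ∀ {m n} → m ≡ n → (m ≡ᵇ n) ≡ true
≡ᵇ-true {m} {n} = dec-true (m ≟ n)

≡ᵇ-false : ∀ {m n} → m ≢ n → (m ≡ᵇ n) ≡ false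
≡ᵇ-false {m} {n} = dec-false (m ≟ n)

≡F-refl : ∀ {n} (a : Fin n) → (a ≡F a) ≡ true
≡F-refl a = ≡ᵇ-true {toℕ a} refl

≡F-≢ : ∀ {n} {a b : Fin n} → a ≢ b → (a ≡F b) ≡ false
≡F-≢ a≢b = ≡ᵇ-false (a≢b ∘ toℕ-injective)

does-≟-true : ∀ b → does (b ≟ᵇ true) ≡ b
does-≟-true true  = refl
does-≟-true false = refl

does-≟-false : ∀ b → does (b ≟ᵇ false) ≡ not b
does-≟-false true  = refl
does-≟-false false = refl

count : ∀ {n} → (Fin n → Bool) → ℕ
count {n} p = ∑[ i < n ] 𝟙 (p i)

sum-mono-≤ : ∀ {n} {f g : Fin n → ℕ} → (∀ i → f i ≤ g i) → sum f ≤ sum g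
sum-mono-≤ {zero}  f≤g = z≤n
sum-mono-≤ {suc n} f≤g = +-mono-≤ (f≤g fzero) (sum-mono-≤ (f≤g ∘ fsuc))

sum-const-1 : ∀ n → ∑[ i < n ] 1 ≡ n
sum-const-1 zero    = refl
sum-const-1 (suc n) = cong suc (sum-const-1 n)

zeroAt : ∀ {n} → Fin n → (Fin n → ℕ) → Fin n → ℕ
zeroAt a f i = if a ≡F i then 0 else f i

sum-zeroAt : ∀ {n} (a : Fin n) (f : Fin n → ℕ) → sum f ≡ f a + sum (zeroAt a f)
sum-zeroAt fzero    f = refl
sum-zeroAt (fsuc a) f = begin
  f fzero + sum (λ i → f (fsuc i))                              ≡⟨ cong (f fzero +_) (sum-zeroAt a (λ i → f (fsuc i))) ⟩
  f fzero + (f (fsuc a) + sum (zeroAt a (λ i → f (fsuc i))))    ≡⟨ x∙yz≈y∙xz (f fzero) (f (fsuc a)) _ ⟩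
  f (fsuc a) + (f fzero + sum (zeroAt a (λ i → f (fsuc i))))    ∎
  where open ≡-Reasoning

zeroAt-≢ : ∀ {n} {a i : Fin n} (f : Fin n → ℕ) → a ≢ i → zeroAt a f i ≡ f i
zeroAt-≢ f a≢i rewrite ≡F-≢ a≢i = refl

sum-point : ∀ {n} (a : Fin n) (g : Fin n → ℕ) → sum (λ i → if a ≡F i then g i else 0) ≡ g a
sum-point {suc n} fzero    g = trans (cong (g fzero +_) (sum-replicate-zero n)) (+-identityʳ _)
sum-point {suc n} (fsuc a) g = sum-point a (λ i → g (fsuc i))

count-point : ∀ {n} (a : Fin n) → count (a ≡F_) ≡ 1
count-point a = trans (sum-cong-≗ (λ i → 𝟙-if (a ≡F i))) (sum-point a (λ _ → 1))

sum-distinct-≤ : ∀ {n} (f : Fin n → ℕ) {ps : List (Fin n)} → Unique ps → ℕ.sum (map f ps) ≤ sum f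
sum-distinct-≤ f []                        = z≤n
sum-distinct-≤ f {p ∷ ps} (p∉ps ∷ unique) = begin
  f p + ℕ.sum (map f ps)                ≡⟨ cong (λ xs → f p + ℕ.sum xs) (map-zeroAt p∉ps) ⟨
  f p + ℕ.sum (map (zeroAt p f) ps)     ≤⟨ +-monoʳ-≤ (f p) (sum-distinct-≤ (zeroAt p f) unique) ⟩
  f p + sum (zeroAt p f)                   ≡⟨ sum-zeroAt p f ⟨
  sum f                                    ∎
  where
  open ≤-Reasoning
  map-zeroAt : ∀ {qs} → All (p ≢_) qs → map (zeroAt p f) qs ≡ map f qs
  map-zeroAt []              = refl
  map-zeroAt (p≢q ∷ p∉qs) = cong₂ _∷_ (zeroAt-≢ f p≢q) (map-zeroAt p∉qs)

sum-if : ∀ {n} (b : Bool) (h : Fin n → ℕ) → sum (λ j → if b then h j else 0) ≡ (if b then sum h else 0)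
sum-if     true  h = refl
sum-if {n} false h = sum-replicate-zero n

sum-row : ∀ {n} (a : Fin n) (e : Fin n → Fin n → ℕ) →
  ∑[ i < n ] ∑[ j < n ] (if a ≡F i then e i j else 0) ≡ ∑[ j < n ] e a j
sum-row a e = trans (sum-cong-≗ (λ i → sum-if (a ≡F i) (e i))) (sum-point a (λ i → sum (e i)))

sum-column : ∀ {n} (a : Fin n) (e : Fin n → Fin n → ℕ) →
  ∑[ i < n ] ∑[ j < n ] (if a ≡F j then e i j else 0) ≡ ∑[ i < n ] e i a
sum-column a e = trans (∑-comm (λ i j → if a ≡F j then e i j else 0)) (sum-row a (λ j i → e i j))

∑∑-distrib-+ : ∀ {n} (f g : Fin n → Fin n → ℕ) →
  ∑[ i < n ] ∑[ j < n ] (f i j + g i j) ≡ ∑[ i < n ] ∑[ j < n ] f i j + ∑[ i < n ] ∑[ j < n ] g i j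
∑∑-distrib-+ f g =
  trans (sum-cong-≗ (λ i → ∑-distrib-+ (f i) (g i))) (∑-distrib-+ (λ i → sum (f i)) (λ i → sum (g i)))

count-complement : ∀ {n} (p : Fin n → Bool) → count p + count (not ∘ p) ≡ n
count-complement {n} p = begin
  count p + count (not ∘ p)          ≡⟨ ∑-distrib-+ (𝟙 ∘ p) (𝟙 ∘ not ∘ p) ⟨
  ∑[ i < n ] (𝟙 (p i) + 𝟙 (not (p i))) ≡⟨ sum-cong-≗ (λ i → one-of (p i)) ⟩
  ∑[ i < n ] 1                       ≡⟨ sum-const-1 n ⟩
  n                                  ∎
  where
  open ≡-Reasoning
  one-of : ∀ b → 𝟙 b + 𝟙 (not b) ≡ 1
  one-of true  = refl
  one-of false = refl

count-mono : ∀ {n} {p q : Fin n → Bool} → (∀ i → p i ≡ true → q i ≡ true) → count p ≤ count q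
count-mono {p = p} {q} p⇒q = sum-mono-≤ (λ i → 𝟙-mono (p⇒q i))
  where
  𝟙-mono : ∀ {a b} → (a ≡ true → b ≡ true) → 𝟙 a ≤ 𝟙 b
  𝟙-mono {false} _   = z≤n
  𝟙-mono {true}  a⇒b rewrite a⇒b refl = ≤-refl

rank : ∀ {n} → (Fin n → Bool) → Fin n → ℕ
rank p fzero    = 0
rank p (fsuc i) = 𝟙 (p fzero) + rank (p ∘ fsuc) i

rank-< : ∀ {n} (p : Fin n → Bool) {i} → p i ≡ true → rank p i < count p
rank-< p {fzero}  pi rewrite pi = s≤s z≤n
rank-< p {fsuc i} pi = +-monoʳ-< (𝟙 (p fzero)) (rank-< (p ∘ fsuc) pi)

rank-injective : ∀ {n} (p : Fin n → Bool) {i j} → p i ≡ true → p j ≡ true → rank p i ≡ rank p j → i ≡ j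
rank-injective p {fzero}  {fzero}  _  _  _ = refl
rank-injective p {fzero}  {fsuc j} pi _  eq rewrite pi with eq
... | ()
rank-injective p {fsuc i} {fzero}  _  pj eq rewrite pj with eq
... | ()
rank-injective p {fsuc i} {fsuc j} pi pj eq =
  cong fsuc (rank-injective (p ∘ fsuc) pi pj (+-cancelˡ-≡ (𝟙 (p fzero)) _ _ eq))

length-filterᵇ : ∀ {A : Set} (p : A → Bool) xs → length (filterᵇ p xs) ≡ ℕ.sum (map (𝟙 ∘ p) xs)
length-filterᵇ p []       = refl
length-filterᵇ p (x ∷ xs) with p x
... | true  = cong suc (length-filterᵇ p xs)
... | false = length-filterᵇ p xs

length-filterᵇ-filterᵇ : ∀ {A : Set} (p q : A → Bool) xs →
  length (filterᵇ q (filterᵇ p xs)) ≡ length (filterᵇ (λ x → p x ∧ q x) xs)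
length-filterᵇ-filterᵇ p q []       = refl
length-filterᵇ-filterᵇ p q (x ∷ xs) with p x
... | false = length-filterᵇ-filterᵇ p q xs
... | true with q x
...   | true  = cong suc (length-filterᵇ-filterᵇ p q xs)
...   | false = length-filterᵇ-filterᵇ p q xs

sum-tabulate : ∀ {n} {A : Set} (h : A → ℕ) (f : Fin n → A) → ℕ.sum (map h (List.tabulate f)) ≡ sum (h ∘ f)
sum-tabulate {zero}  h f = refl
sum-tabulate {suc n} h f = cong (h (f fzero) +_) (sum-tabulate h (f ∘ fsuc))

sum-cartesianProduct : ∀ {A B : Set} (h : A × B → ℕ) xs ys →
  ℕ.sum (map h (cartesianProduct xs ys)) ≡ ℕ.sum (map (λ x → ℕ.sum (map (λ y → h (x , y)) ys)) xs)
sum-cartesianProduct h []       ys = refl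
sum-cartesianProduct h (x ∷ xs) ys = begin
  ℕ.sum (map h (map (x ,_) ys ++ cartesianProduct xs ys))
    ≡⟨ cong ℕ.sum (map-++ h (map (x ,_) ys) _) ⟩
  ℕ.sum (map h (map (x ,_) ys) ++ map h (cartesianProduct xs ys))
    ≡⟨ sum-++ (map h (map (x ,_) ys)) _ ⟩
  ℕ.sum (map h (map (x ,_) ys)) + ℕ.sum (map h (cartesianProduct xs ys))
    ≡⟨ cong₂ _+_ (cong ℕ.sum (sym (map-∘ ys))) (sum-cartesianProduct h xs ys) ⟩
  ℕ.sum (map (λ y → h (x , y)) ys) + ℕ.sum (map (λ x → ℕ.sum (map (λ y → h (x , y)) ys)) xs)
    ∎
  where open ≡-Reasoning

length-filterᵇ-pairs : ∀ {n} (P : Fin n × Fin n → Bool) →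
  length (filterᵇ P (cartesianProduct (allFin n) (allFin n))) ≡ ∑[ i < n ] ∑[ j < n ] 𝟙 (P (i , j))
length-filterᵇ-pairs {n} P = begin
  length (filterᵇ P (cartesianProduct (allFin n) (allFin n)))
    ≡⟨ length-filterᵇ P (cartesianProduct (allFin n) (allFin n)) ⟩
  ℕ.sum (map (𝟙 ∘ P) (cartesianProduct (allFin n) (allFin n)))
    ≡⟨ sum-cartesianProduct (𝟙 ∘ P) (allFin n) (allFin n) ⟩
  ℕ.sum (map (λ i → ℕ.sum (map (λ j → 𝟙 (P (i , j))) (allFin n))) (allFin n))
    ≡⟨ sum-tabulate (λ i → ℕ.sum (map (λ j → 𝟙 (P (i , j))) (allFin n))) (λ i → i) ⟩
  ∑[ i < n ] ℕ.sum (map (λ j → 𝟙 (P (i , j))) (allFin n))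
    ≡⟨ sum-cong-≗ (λ i → sum-tabulate (λ j → 𝟙 (P (i , j))) (λ j → j)) ⟩
  ∑[ i < n ] ∑[ j < n ] 𝟙 (P (i , j))
    ∎
  where open ≡-Reasoning

foldr-⊓-≤-init : ∀ y ys → List.foldr _⊓_ y ys ≤ y
foldr-⊓-≤-init y []       = ≤-refl
foldr-⊓-≤-init y (z ∷ zs) = ≤-trans (m⊓n≤n z _) (foldr-⊓-≤-init y zs)

foldr-⊓-≤ : ∀ {x} y {ys} → x ∈ ys → List.foldr _⊓_ y ys ≤ x
foldr-⊓-≤ y (here refl) = m⊓n≤m _ _
foldr-⊓-≤ y (there x∈ys) = ≤-trans (m⊓n≤n _ _) (foldr-⊓-≤ y x∈ys)

minℕ-≤ : ∀ {x xs} → x ∈ xs → minℕ xs ≤ x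
minℕ-≤ {xs = y ∷ ys} (here refl)  = foldr-⊓-≤-init y ys
minℕ-≤ {xs = y ∷ ys} (there x∈ys) = foldr-⊓-≤ y x∈ys

lookup-injective : ∀ {A : Set} {xs : List A} → Unique xs → Injective _≡_ _≡_ (List.lookup xs)
lookup-injective {xs = x ∷ xs} (x∉xs ∷ unique) {fzero}  {fzero}  _  = refl
lookup-injective {xs = x ∷ xs} (x∉xs ∷ unique) {fzero}  {fsuc j} eq = ⊥-elim (All.lookup x∉xs (∈-lookup j) eq)
lookup-injective {xs = x ∷ xs} (x∉xs ∷ unique) {fsuc i} {fzero}  eq = ⊥-elim (All.lookup x∉xs (∈-lookup i) (sym eq))
lookup-injective {xs = x ∷ xs} (x∉xs ∷ unique) {fsuc i} {fsuc j} eq = cong fsuc (lookup-injective unique eq)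

⌊bit+double/2⌋ : ∀ b r → ⌊ 𝟙 b + 2 * r /2⌋ ≡ r
⌊bit+double/2⌋ false zero    = refl
⌊bit+double/2⌋ true  zero    = refl
⌊bit+double/2⌋ false (suc r) rewrite +-suc r (r + 0) = cong suc (⌊bit+double/2⌋ false r)
⌊bit+double/2⌋ true  (suc r) rewrite +-suc r (r + 0) = cong suc (⌊bit+double/2⌋ true r)

bit+double-injective : ∀ a b r s → 𝟙 a + 2 * r ≡ 𝟙 b + 2 * s → a ≡ b × r ≡ s
bit+double-injective a b r s eq =
  bits (+-cancelʳ-≡ (2 * r) (𝟙 a) (𝟙 b) (trans eq (cong (λ q → 𝟙 b + 2 * q) (sym r≡s)))) , r≡s
  where
  r≡s : r ≡ s
  r≡s = trans (sym (⌊bit+double/2⌋ a r)) (trans (cong ⌊_/2⌋ eq) (⌊bit+double/2⌋ b s))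
  bits : ∀ {a b} → 𝟙 a ≡ 𝟙 b → a ≡ b
  bits {false} {false} _ = refl
  bits {true}  {true}  _ = refl

bit+double-< : ∀ b {r t} → r < t → 𝟙 b + 2 * r < t + t
bit+double-< b {r} {t} r<t = begin-strict
  𝟙 b + 2 * r      ≤⟨ +-monoˡ-≤ (2 * r) (bit≤1 b) ⟩
  1 + 2 * r        <⟨ n<1+n _ ⟩
  2 + 2 * r        ≡⟨ cong (λ q → 2 + q) (cong (r +_) (+-identityʳ r)) ⟩
  2 + (r + r)      ≡⟨ cong suc (+-suc r r) ⟨
  suc r + suc r    ≤⟨ +-mono-≤ r<t r<t ⟩
  t + t            ∎
  where
  open ≤-Reasoning
  bit≤1 : ∀ b → 𝟙 b ≤ 1
  bit≤1 false = z≤n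
  bit≤1 true  = ≤-refl

squeeze : ∀ {a b F} → a + b ≤ F → F ≤ 2 * a → F ≤ 2 * b → a ≡ b × F ≡ a + b
squeeze {a} {b} {F} a+b≤F F≤2a F≤2b = a≡b , ≤-antisym F≤a+b a+b≤F
  where
  double : ∀ c → 2 * c ≡ c + c
  double c = cong (c +_) (+-identityʳ c)
  a≡b : a ≡ b
  a≡b = ≤-antisym (+-cancelʳ-≤ b a b (≤-trans a+b≤F (subst (F ≤_) (double b) F≤2b)))
                  (+-cancelˡ-≤ a b a (≤-trans a+b≤F (subst (F ≤_) (double a) F≤2a)))
  F≤a+b : F ≤ a + b
  F≤a+b = subst (F ≤_) (trans (double a) (cong (a +_) a≡b)) F≤2a

twice-sum-≤-twice⇒0 : ∀ {a b F} → F ≡ 2 * (a + b) → F ≤ 2 * a → b ≡ 0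
twice-sum-≤-twice⇒0 {a} {b} refl le =
  n≤0⇒n≡0 (+-cancelˡ-≤ a b 0 (subst (a + b ≤_) (sym (+-identityʳ a)) (*-cancelˡ-≤ 2 le)))

-- Degrees and the sets S₁(e)

-- The summand of S1size-bound at (i , j), for p = edgeᵇ i j, a = u ≡F i, b = u ≡F j, c = v ≡F i, d = v ≡F j.
S1-pointwise : ∀ p a b c d →
  𝟙 (p ∧ (not (a ∧ d) ∧ (a ∨ b ∨ c ∨ d))) + (𝟙 (p ∧ (a ∧ d)) + 𝟙 (p ∧ (a ∧ d)))
    ≤ 𝟙 (p ∧ (a ∨ b)) + 𝟙 (p ∧ (c ∨ d))
S1-pointwise false _     _     _     _     = z≤n
S1-pointwise true  true  _     true  true  = ≤-refl
S1-pointwise true  true  _     false true  = ≤-refl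
S1-pointwise true  true  _     _     false = s≤s z≤n
S1-pointwise true  false true  _     _     = s≤s z≤n
S1-pointwise true  false false _     _     = ≤-reflexive (+-identityʳ _)

module _ {n} (G : Graph n) where

  edgeᵇ : Fin n → Fin n → Bool
  edgeᵇ i j = (toℕ i <ᵇ toℕ j) ∧ adj G i j

  numEdges-sum : numEdges G ≡ ∑[ i < n ] ∑[ j < n ] 𝟙 (edgeᵇ i j)
  numEdges-sum = length-filterᵇ-pairs (λ p → edgeᵇ (proj₁ p) (proj₂ p))

  deg : Fin n → ℕ
  deg v = count (adj G v)

  edgeᵇ-irrefl : ∀ i → edgeᵇ i i ≡ false
  edgeᵇ-irrefl i rewrite irrefl G i = ∧-zeroʳ _

  adj-edgeᵇ : ∀ i j → 𝟙 (adj G i j) ≡ 𝟙 (edgeᵇ i j) + 𝟙 (edgeᵇ j i)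
  adj-edgeᵇ i j with <-cmp (toℕ i) (toℕ j)
  ... | tri< i<j _ j≮i rewrite <ᵇ-true i<j | <ᵇ-false j≮i = sym (+-identityʳ _)
  ... | tri> i≮j _ j<i rewrite <ᵇ-false i≮j | <ᵇ-true j<i | Graph.sym G i j = refl
  ... | tri≈ _ i≡j _ rewrite toℕ-injective i≡j | edgeᵇ-irrefl j | irrefl G j = refl

  deg-edgeᵇ : ∀ u → deg u ≡ ∑[ j < n ] 𝟙 (edgeᵇ u j) + ∑[ j < n ] 𝟙 (edgeᵇ j u)
  deg-edgeᵇ u = trans (sum-cong-≗ (adj-edgeᵇ u)) (∑-distrib-+ (λ j → 𝟙 (edgeᵇ u j)) (λ j → 𝟙 (edgeᵇ j u)))

  handshake : ∑[ v < n ] deg v ≡ 2 * numEdges G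
  handshake = begin
    ∑[ v < n ] deg v
      ≡⟨ sum-cong-≗ deg-edgeᵇ ⟩
    ∑[ v < n ] (∑[ j < n ] 𝟙 (edgeᵇ v j) + ∑[ j < n ] 𝟙 (edgeᵇ j v))
      ≡⟨ ∑-distrib-+ (λ v → ∑[ j < n ] 𝟙 (edgeᵇ v j)) (λ v → ∑[ j < n ] 𝟙 (edgeᵇ j v)) ⟩
    ∑[ v < n ] ∑[ j < n ] 𝟙 (edgeᵇ v j) + ∑[ v < n ] ∑[ j < n ] 𝟙 (edgeᵇ j v)
      ≡⟨ cong (E +_) (∑-comm (λ v j → 𝟙 (edgeᵇ j v))) ⟩
    E + E
      ≡⟨ cong₂ _+_ numEdges-sum (trans (+-identityʳ _) numEdges-sum) ⟨
    2 * numEdges G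
      ∎
    where
    open ≡-Reasoning
    E : ℕ
    E = ∑[ i < n ] ∑[ j < n ] 𝟙 (edgeᵇ i j)

  S1size-sum : ∀ u v → S1size G (u , v) ≡
    ∑[ i < n ] ∑[ j < n ] 𝟙 (edgeᵇ i j ∧ (not (sameEdge (u , v) (i , j)) ∧ shareEndpoint (u , v) (i , j)))
  S1size-sum u v = trans
    (length-filterᵇ-filterᵇ (λ p → edgeᵇ (proj₁ p) (proj₂ p)) Q (cartesianProduct (allFin n) (allFin n)))
    (length-filterᵇ-pairs (λ p → edgeᵇ (proj₁ p) (proj₂ p) ∧ Q p))
    where
    Q : Fin n × Fin n → Bool
    Q e = not (sameEdge (u , v) e) ∧ shareEndpoint (u , v) e

  incident-pointwise : ∀ w i j → 𝟙 (edgeᵇ i j ∧ ((w ≡F i) ∨ (w ≡F j))) ≡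
    (if w ≡F i then 𝟙 (edgeᵇ i j) else 0) + (if w ≡F j then 𝟙 (edgeᵇ i j) else 0)
  incident-pointwise w i j with w ≟ᶠ i | w ≟ᶠ j
  ... | yes refl | yes refl rewrite ≡F-refl w | edgeᵇ-irrefl w = refl
  ... | yes refl | no w≢j rewrite ≡F-refl w | ≡F-≢ w≢j with edgeᵇ w j
  ...   | true  = refl
  ...   | false = refl
  incident-pointwise w i j | no w≢i | yes refl rewrite ≡F-refl w | ≡F-≢ w≢i with edgeᵇ i w
  ...   | true  = refl
  ...   | false = refl
  incident-pointwise w i j | no w≢i | no w≢j rewrite ≡F-≢ w≢i | ≡F-≢ w≢j = cong 𝟙 (∧-zeroʳ _)

  incident-sum : ∀ w → ∑[ i < n ] ∑[ j < n ] 𝟙 (edgeᵇ i j ∧ ((w ≡F i) ∨ (w ≡F j))) ≡ deg w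
  incident-sum w = begin
    ∑[ i < n ] ∑[ j < n ] 𝟙 (edgeᵇ i j ∧ ((w ≡F i) ∨ (w ≡F j)))
      ≡⟨ sum-cong-≗ (λ i → sum-cong-≗ (incident-pointwise w i)) ⟩
    ∑[ i < n ] ∑[ j < n ] ((if w ≡F i then e i j else 0) + (if w ≡F j then e i j else 0))
      ≡⟨ ∑∑-distrib-+ (λ i j → if w ≡F i then e i j else 0) (λ i j → if w ≡F j then e i j else 0) ⟩
    ∑[ i < n ] ∑[ j < n ] (if w ≡F i then e i j else 0) + ∑[ i < n ] ∑[ j < n ] (if w ≡F j then e i j else 0)
      ≡⟨ cong₂ _+_ (sum-row w e) (sum-column w e) ⟩
    ∑[ j < n ] e w j + ∑[ i < n ] e i w
      ≡⟨ deg-edgeᵇ w ⟨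
    deg w
      ∎
    where
    open ≡-Reasoning
    e : Fin n → Fin n → ℕ
    e i j = 𝟙 (edgeᵇ i j)

  single-edge-sum : ∀ {u v} → edgeᵇ u v ≡ true →
    ∑[ i < n ] ∑[ j < n ] 𝟙 (edgeᵇ i j ∧ ((u ≡F i) ∧ (v ≡F j))) ≡ 1
  single-edge-sum {u} {v} uv = begin
    ∑[ i < n ] ∑[ j < n ] 𝟙 (edgeᵇ i j ∧ ((u ≡F i) ∧ (v ≡F j)))
      ≡⟨ sum-cong-≗ (λ i → sum-cong-≗ (pointwise i)) ⟩
    ∑[ i < n ] ∑[ j < n ] (if u ≡F i then (if v ≡F j then 𝟙 (edgeᵇ i j) else 0) else 0)
      ≡⟨ sum-row u (λ i j → if v ≡F j then 𝟙 (edgeᵇ i j) else 0) ⟩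
    ∑[ j < n ] (if v ≡F j then 𝟙 (edgeᵇ u j) else 0)
      ≡⟨ sum-point v (λ j → 𝟙 (edgeᵇ u j)) ⟩
    𝟙 (edgeᵇ u v)
      ≡⟨ cong 𝟙 uv ⟩
    1
      ∎
    where
    open ≡-Reasoning
    pointwise : ∀ i j → 𝟙 (edgeᵇ i j ∧ ((u ≡F i) ∧ (v ≡F j))) ≡
      (if u ≡F i then (if v ≡F j then 𝟙 (edgeᵇ i j) else 0) else 0)
    pointwise i j with u ≡F i | v ≡F j
    ... | true  | true  = cong 𝟙 (∧-identityʳ _)
    ... | true  | false = cong 𝟙 (∧-zeroʳ _)
    ... | false | _     = cong 𝟙 (∧-zeroʳ _)

  S1size-bound : ∀ {u v} → edgeᵇ u v ≡ true → S1size G (u , v) + 2 ≤ deg u + deg v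
  S1size-bound {u} {v} uv = begin
    S1size G (u , v) + 2
      ≡⟨ cong₂ _+_ (sym (S1size-sum u v)) (cong₂ _+_ (single-edge-sum uv) (single-edge-sum uv)) ⟨
    ∑∑ L + (∑∑ M + ∑∑ M)
      ≡⟨ cong (∑∑ L +_) (∑∑-distrib-+ M M) ⟨
    ∑∑ L + ∑∑ (λ i j → M i j + M i j)
      ≡⟨ ∑∑-distrib-+ L (λ i j → M i j + M i j) ⟨
    ∑∑ (λ i j → L i j + (M i j + M i j))
      ≤⟨ sum-mono-≤ (λ i → sum-mono-≤ (λ j →
           S1-pointwise (edgeᵇ i j) (u ≡F i) (u ≡F j) (v ≡F i) (v ≡F j))) ⟩
    ∑∑ (λ i j → Rᵘ i j + Rᵛ i j)
      ≡⟨ ∑∑-distrib-+ Rᵘ Rᵛ ⟩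
    ∑∑ Rᵘ + ∑∑ Rᵛ
      ≡⟨ cong₂ _+_ (incident-sum u) (incident-sum v) ⟩
    deg u + deg v
      ∎
    where
    open ≤-Reasoning
    ∑∑ : (Fin n → Fin n → ℕ) → ℕ
    ∑∑ f = ∑[ i < n ] ∑[ j < n ] f i j
    L M Rᵘ Rᵛ : Fin n → Fin n → ℕ
    L i j = 𝟙 (edgeᵇ i j ∧ (not (sameEdge (u , v) (i , j)) ∧ shareEndpoint (u , v) (i , j)))
    M i j = 𝟙 (edgeᵇ i j ∧ ((u ≡F i) ∧ (v ≡F j)))
    Rᵘ i j = 𝟙 (edgeᵇ i j ∧ ((u ≡F i) ∨ (u ≡F j)))
    Rᵛ i j = 𝟙 (edgeᵇ i j ∧ ((v ≡F i) ∨ (v ≡F j)))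

  minS1-≤ : ∀ {u v} → edgeᵇ u v ≡ true → minS1 G ≤ S1size G (u , v)
  minS1-≤ {u} {v} uv = minℕ-≤ (∈-map⁺ (S1size G) uv∈edges)
    where
    uv∈edges : (u , v) ∈ edges G
    uv∈edges = ∈-filter⁺ (λ p → T? (edgeᵇ (proj₁ p) (proj₂ p)))
                 (∈-cartesianProduct⁺ (∈-allFin u) (∈-allFin v)) (subst T (sym uv) _)

module Basics {n} (G : Graph n) where

  infix 4 _~_ _≁_
  _~_ _≁_ : Fin n → Fin n → Set
  u ~ v = adj G u v ≡ true
  u ≁ v = adj G u v ≡ false

  ~-sym : ∀ {u v} → u ~ v → v ~ u
  ~-sym {u} {v} uv = trans (Graph.sym G v u) uv

  ~-≢ : ∀ {u v} → u ~ v → u ≢ v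
  ~-≢ {u} uu refl with trans (sym uu) (irrefl G u)
  ... | ()

  ¬~⇒≁ : ∀ {u v} → ¬ u ~ v → u ≁ v
  ¬~⇒≁ = ¬-not

  ≁⇒¬~ : ∀ {u v} → u ≁ v → ¬ u ~ v
  ≁⇒¬~ u≁v uv with trans (sym uv) u≁v
  ... | ()

  bipartite-noTriangle : Bipartite G → ∀ {u v w} → u ~ v → v ~ w → u ~ w → ⊥
  bipartite-noTriangle (colour , proper) {u} {v} {w} uv vw uw =
    two-colours (colour u) (colour v) (colour w) (proper u v uv) (proper v w vw) (proper u w uw)
    where
    two-colours : ∀ a b c → a ≢ b → b ≢ c → a ≢ c → ⊥
    two-colours true  true  _     a≢b _   _   = a≢b refl
    two-colours false false _     a≢b _   _   = a≢b refl
    two-colours true  false true  _   _   a≢c = a≢c refl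
    two-colours false true  false _   _   a≢c = a≢c refl
    two-colours true  false false _   b≢c _   = b≢c refl
    two-colours false true  true  _   b≢c _   = b≢c refl

  forest-noSquare : Forest G → ∀ {a b c d} → a ≢ c → b ≢ d → a ~ b → b ~ c → c ~ d → d ~ a → ⊥
  forest-noSquare forest {a} {b} {c} {d} a≢c b≢d ab bc cd da = forest record
    { L = 3 ; long = s≤s (s≤s z≤n) ; c = vertex ; inj = lookup-injective distinct ; step = step ; close = da }
    where
    vertex : Fin 4 → Fin n
    vertex = List.lookup (a ∷ b ∷ c ∷ d ∷ [])
    distinct : Unique (a ∷ b ∷ c ∷ d ∷ [])
    distinct = (~-≢ ab ∷ a≢c ∷ (λ a≡d → ~-≢ da (sym a≡d)) ∷ [])
             ∷ (~-≢ bc ∷ b≢d ∷ []) ∷ (~-≢ cd ∷ []) ∷ [] ∷ []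
    step : ∀ i → vertex (inject₁ i) ~ vertex (fsuc i)
    step fzero               = ab
    step (fsuc fzero)        = bc
    step (fsuc (fsuc fzero)) = cd

  deg-≥1 : ∀ {u v} → u ~ v → 1 ≤ deg G u
  deg-≥1 {u} {v} uv = subst (_≤ deg G u) (cong (λ b → 𝟙 b + 0) uv)
    (sum-distinct-≤ (λ z → 𝟙 (adj G u z)) {v ∷ []} ([] ∷ []))

  deg-≥2 : ∀ {u v w} → u ~ v → u ~ w → v ≢ w → 2 ≤ deg G u
  deg-≥2 {u} {v} {w} uv uw v≢w = subst (_≤ deg G u) (cong₂ (λ a b → 𝟙 a + (𝟙 b + 0)) uv uw)
    (sum-distinct-≤ (λ z → 𝟙 (adj G u z)) ((v≢w ∷ []) ∷ [] ∷ []))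

  deg-≤1 : ∀ {u v} → (∀ z → u ~ z → z ≡ v) → deg G u ≤ 1
  deg-≤1 {u} {v} only-v = subst (deg G u ≤_) (count-point v)
    (count-mono (λ z uz → subst (λ y → (y ≡F z) ≡ true) (only-v z uz) (≡F-refl z)))

  deg-≤1-unique : ∀ {u v w} → deg G u ≤ 1 → u ~ v → u ~ w → v ≡ w
  deg-≤1-unique {v = v} {w} deg≤1 uv uw with v ≟ᶠ w
  ... | yes v≡w = v≡w
  ... | no  v≢w = ⊥-elim (<-irrefl refl (≤-trans (deg-≥2 uv uw v≢w) deg≤1))

injective⇒surjective : ∀ {n} (g : Fin n → Fin n) → Injective _≡_ _≡_ g → ∀ y → Σ (Fin n) λ x → g x ≡ y
injective⇒surjective {suc n} g g-inj y with any? (λ x → g x ≟ᶠ y)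
... | yes hit = hit
... | no miss = ⊥-elim (<-irrefl refl (injective⇒≤ h-inj))
  where
  h : Fin (suc n) → Fin n
  h x = punchOut {i = y} (λ y≡gx → miss (x , sym y≡gx))
  h-inj : Injective _≡_ _≡_ h
  h-inj {x} {z} eq = g-inj (punchOut-injective (λ y≡gx → miss (x , sym y≡gx)) (λ y≡gz → miss (z , sym y≡gz)) eq)

isoFromInjection : ∀ {n N} (G : Graph n) (a : Fin N → Fin N → Bool) (g : Fin n → Fin N) →
  n ≡ N → Injective _≡_ _≡_ g → (∀ i j → adj G i j ≡ a (g i) (g j)) → IsoTo G N a
isoFromInjection {n} G a g refl g-inj g-adj =
  mk↔ₛ′ g g⁻¹ (λ y → proj₂ (surj y)) (λ x → g-inj (proj₂ (surj (g x)))) , g-adj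
  where
  surj : ∀ y → Σ (Fin n) λ x → g x ≡ y
  surj = injective⇒surjective g g-inj
  g⁻¹ : Fin n → Fin n
  g⁻¹ y = proj₁ (surj y)

-- Vertices of class c are sent, in increasing order, to the block of positions starting at offset c.
-- For each exceptional graph, comb (feature p) (feature q) unfolds to its adjacency of positions p, q.
module Layout {n} (G : Graph n) {C : Set} (_≟ᶜ_ : DecidableEquality C) (class : Fin n → C) where

  inClass : C → Fin n → Bool
  inClass c i = does (class i ≟ᶜ c)

  classSize : C → ℕ
  classSize c = count (inClass c)

  isoByLayout : ∀ {N} {F : Set} (comb : F → F → Bool) (feature : ℕ → F) (label : C → F) (offset : C → ℕ) →
    Injective _≡_ _≡_ label →
    (∀ c r → r < classSize c → offset c + r < N × feature (offset c + r) ≡ label c) →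
    (∀ i j → adj G i j ≡ comb (label (class i)) (label (class j))) →
    n ≡ N → IsoTo G N (λ x y → comb (feature (toℕ x)) (feature (toℕ y)))
  isoByLayout {N} comb feature label offset label-inj fits G-adj n≡N =
    isoFromInjection G (λ x y → comb (feature (toℕ x)) (feature (toℕ y))) g n≡N g-inj g-adj
    where
    inOwnClass : ∀ i → inClass (class i) i ≡ true
    inOwnClass i = dec-true (class i ≟ᶜ class i) refl

    position : Fin n → ℕ
    position i = offset (class i) + rank (inClass (class i)) i

    fits-at : ∀ i → position i < N × feature (position i) ≡ label (class i)
    fits-at i = fits (class i) _ (rank-< (inClass (class i)) (inOwnClass i))

    g : Fin n → Fin N
    g i = fromℕ< (proj₁ (fits-at i))

    feature-g : ∀ i → feature (toℕ (g i)) ≡ label (class i)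
    feature-g i = trans (cong feature (toℕ-fromℕ< _)) (proj₂ (fits-at i))

    g-inj : Injective _≡_ _≡_ g
    g-inj {i} {j} gi≡gj = rank-injective (inClass (class i)) (inOwnClass i) j∈ ranks
      where
      same-class : class i ≡ class j
      same-class = label-inj (trans (sym (feature-g i)) (trans (cong (feature ∘ toℕ) gi≡gj) (feature-g j)))
      j∈ : inClass (class i) j ≡ true
      j∈ = subst (λ c → inClass c j ≡ true) (sym same-class) (inOwnClass j)
      positions : position i ≡ position j
      positions = trans (sym (toℕ-fromℕ< _)) (trans (cong toℕ gi≡gj) (toℕ-fromℕ< _))
      ranks : rank (inClass (class i)) i ≡ rank (inClass (class i)) j
      ranks = +-cancelˡ-≡ (offset (class i)) _ _
        (trans positions (cong (λ c → offset c + rank (inClass c) j) (sym same-class)))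

    g-adj : ∀ i j → adj G i j ≡ comb (feature (toℕ (g i))) (feature (toℕ (g j)))
    g-adj i j = trans (G-adj i j) (sym (cong₂ comb (feature-g i) (feature-g j)))

-- Stars, double stars and matchings

module Star {n} (G : Graph n) (noIsolated : NoIsolated G) (c : Fin n) where
  open Basics G
  open Layout G _≟ᵇ_ (c ≡F_)

  leaves : ℕ
  leaves = classSize false

  isStar : (∀ {i j} → i ~ j → i ≡ c ⊎ j ≡ c) → (w : Fin n) → w ≢ c → IsStar G
  isStar centred w w≢c =
    leaves , leaves≥1 , isoByLayout _xor_ (_≡ᵇ 0) id offset id fits class-adj n≡1+leaves
    where
    offset : Bool → ℕ
    offset true  = 0
    offset false = 1

    centre-size : classSize true ≡ 1
    centre-size = trans (sum-cong-≗ (λ i → cong 𝟙 (does-≟-true (c ≡F i)))) (count-point c)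

    n≡1+leaves : n ≡ suc leaves
    n≡1+leaves = trans (sym (count-complement (c ≡F_)))
      (cong₂ _+_ (count-point c) (sum-cong-≗ (λ i → cong 𝟙 (sym (does-≟-false (c ≡F i))))))

    leaves≥1 : 1 ≤ leaves
    leaves≥1 = subst (_≤ leaves) (cong (λ b → 𝟙 b + 0) w-leaf)
                     (sum-distinct-≤ (𝟙 ∘ inClass false) {w ∷ []} ([] ∷ []))
      where
      w-leaf : inClass false w ≡ true
      w-leaf = trans (does-≟-false (c ≡F w)) (cong not (≡F-≢ (≢-sym w≢c)))

    fits : ∀ b r → r < classSize b → offset b + r < suc leaves × ((offset b + r) ≡ᵇ 0) ≡ b
    fits true  r r<1 rewrite n<1⇒n≡0 (subst (r <_) centre-size r<1) = s≤s z≤n , refl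
    fits false r r<leaves = s≤s r<leaves , refl

    toCentre : ∀ {j} → j ≢ c → c ~ j
    toCentre {j} j≢c with noIsolated j
    ... | z , jz with centred jz
    ...   | inj₁ j≡c = ⊥-elim (j≢c j≡c)
    ...   | inj₂ refl = ~-sym jz

    class-adj : ∀ i j → adj G i j ≡ (c ≡F i) xor (c ≡F j)
    class-adj i j with c ≟ᶠ i | c ≟ᶠ j
    ... | yes refl | yes refl rewrite ≡F-refl c = irrefl G c
    ... | yes refl | no c≢j   rewrite ≡F-refl c | ≡F-≢ c≢j = toCentre (≢-sym c≢j)
    ... | no c≢i   | yes refl rewrite ≡F-refl c | ≡F-≢ c≢i = ~-sym (toCentre (≢-sym c≢i))
    ... | no c≢i   | no c≢j   rewrite ≡F-≢ c≢i | ≡F-≢ c≢j =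
      ¬~⇒≁ λ ij → [ ≢-sym c≢i , ≢-sym c≢j ] (centred ij)

LeafOf : ∀ {n} → Graph n → Fin n → Fin n → Set
LeafOf G w c = adj G w c ≡ true × (∀ z → adj G w z ≡ true → z ≡ c)

-- On which centre's side a vertex lies, and whether it is that centre.
Role : Set
Role = Bool × Bool

pattern centreˣ = (true , true)
pattern leafˣ   = (true , false)
pattern centreʸ = (false , true)
pattern leafʸ   = (false , false)

_≟ᴿ_ : DecidableEquality Role
_≟ᴿ_ = ≡-dec _≟ᵇ_ _≟ᵇ_

roleAdj : Bool → Role → Role → Bool
roleAdj xy centreˣ centreʸ = xy
roleAdj xy centreʸ centreˣ = xy
roleAdj _  centreˣ leafˣ   = true
roleAdj _  leafˣ   centreˣ = true
roleAdj _  centreʸ leafʸ   = true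
roleAdj _  leafʸ   centreʸ = true
roleAdj _  _       _       = false

roleCount : ℕ → Role → ℕ
roleCount m (_ , true)  = 1
roleCount m (_ , false) = m

-- H² = H³ with m leaves per centre: x-side at positions 0 … m, y-side at m + 1 … 2m + 1.
module TwoStarLayout (m : ℕ) where

  comb : Role → Role → Bool
  comb (s , z) (s′ , z′) = not (s xor s′) ∧ (z xor z′)

  feature : ℕ → Role
  feature p = (p <ᵇ suc m) , ((if p <ᵇ suc m then p else p ∸ suc m) ≡ᵇ 0)

  offset : Role → ℕ
  offset centreˣ = 0
  offset leafˣ   = 1
  offset centreʸ = suc m
  offset leafʸ   = suc (suc m)

  fits : ∀ c r → r < roleCount m c → offset c + r < suc m + suc m × feature (offset c + r) ≡ c
  fits centreˣ r r<1 rewrite n<1⇒n≡0 r<1 = s≤s z≤n , refl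
  fits leafˣ   r r<m rewrite <ᵇ-true r<m = s≤s (≤-trans r<m (m≤m+n m (suc m))) , refl
  fits centreʸ r r<1 rewrite n<1⇒n≡0 r<1 | +-identityʳ m | <ᵇ-false (n≮n m) | n∸n≡0 m = s≤s (m<m+n m (s≤s z≤n)) , refl
  fits leafʸ   r r<m = subst (λ p → p < suc m + suc m × feature p ≡ leafʸ) (+-suc (suc m) r) (bound , label-ok)
    where
    bound : suc m + suc r < suc m + suc m
    bound = +-monoʳ-< (suc m) (s≤s r<m)
    label-ok : feature (suc m + suc r) ≡ leafʸ
    label-ok rewrite <ᵇ-false (≤⇒≯ (m≤m+n (suc m) (suc r))) | m+n∸m≡n (suc m) (suc r) = refl

  table : ∀ r s → roleAdj false r s ≡ comb r s
  table centreˣ centreˣ = refl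
  table centreˣ leafˣ   = refl
  table centreˣ centreʸ = refl
  table centreˣ leafʸ   = refl
  table leafˣ   centreˣ = refl
  table leafˣ   leafˣ   = refl
  table leafˣ   centreʸ = refl
  table leafˣ   leafʸ   = refl
  table centreʸ centreˣ = refl
  table centreʸ leafˣ   = refl
  table centreʸ centreʸ = refl
  table centreʸ leafʸ   = refl
  table leafʸ   centreˣ = refl
  table leafʸ   leafˣ   = refl
  table leafʸ   centreʸ = refl
  table leafʸ   leafʸ   = refl

-- H⁴ with k = K + 1: u₁ = x at position 0, the leaves u₂ … uₖ of y, the leaves v₁ … v_K of x, vₖ = y.
module H4Layout (K : ℕ) where

  -- (toℕ p < k, p = u₁, p = vₖ) in the numbering of H4Adj
  Shape : Set
  Shape = Bool × Bool × Bool

  comb : Shape → Shape → Bool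
  comb (u , z , l) (u′ , z′ , l′) = (u ∧ not u′ ∧ (z ∨ l′)) ∨ (u′ ∧ not u ∧ (z′ ∨ l))

  feature : ℕ → Shape
  feature p = (p <ᵇ suc K) , (p ≡ᵇ 0) , (p ≡ᵇ K + suc K)

  label : Role → Shape
  label centreˣ = true  , true  , false
  label leafʸ   = true  , false , false
  label leafˣ   = false , false , false
  label centreʸ = false , false , true

  label-injective : Injective _≡_ _≡_ label
  label-injective {r} {s} eq = trans (sym (retract r)) (trans (cong role-of eq) (retract s))
    where
    role-of : Shape → Role
    role-of (u , z , l) = (if u then z else not l) , (if u then z else l)
    retract : ∀ r → role-of (label r) ≡ r
    retract centreˣ = refl
    retract leafʸ   = refl
    retract leafˣ   = refl
    retract centreʸ = refl

  offset : Role → ℕ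
  offset centreˣ = 0
  offset leafʸ   = 1
  offset leafˣ   = suc K
  offset centreʸ = K + suc K

  suc-K≤last : suc K ≤ K + suc K
  suc-K≤last = m≤n+m (suc K) K

  last≢ : ∀ {p} → p < K + suc K → (p ≡ᵇ K + suc K) ≡ false
  last≢ p<last = ≡ᵇ-false (<⇒≢ p<last)

  fits : ∀ c r → r < roleCount K c → offset c + r < suc K + suc K × feature (offset c + r) ≡ label c
  fits centreˣ r r<1 rewrite n<1⇒n≡0 r<1 =
    s≤s z≤n , cong (λ b → true , true , b) (last≢ (<-≤-trans (s≤s z≤n) suc-K≤last))
  fits leafʸ r r<K = s≤s (≤-trans r<K (m≤m+n K (suc K))) ,
    cong₂ _,_ (<ᵇ-true r<K) (cong (false ,_) (last≢ (≤-trans (s≤s r<K) suc-K≤last)))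
  fits leafˣ r r<K = +-monoʳ-< (suc K) (m<n⇒m<1+n r<K) ,
    cong₂ _,_ (<ᵇ-false (≤⇒≯ (m≤m+n (suc K) r)))
              (cong (false ,_) (last≢ (subst (suc K + r <_) (+-comm (suc K) K) (+-monoʳ-< (suc K) r<K))))
  fits centreʸ r r<1 rewrite n<1⇒n≡0 r<1 | +-identityʳ (K + suc K) =
    n<1+n _ , cong₂ _,_ (<ᵇ-false (≤⇒≯ suc-K≤last)) (cong₂ _,_ (≡ᵇ-false (m<n⇒n≢0 suc-K≤last)) (≡ᵇ-true {K + suc K} refl))

  table : ∀ r s → roleAdj true r s ≡ comb (label r) (label s)
  table centreˣ centreˣ = refl
  table centreˣ leafˣ   = refl
  table centreˣ centreʸ = refl
  table centreˣ leafʸ   = refl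
  table leafˣ   centreˣ = refl
  table leafˣ   leafˣ   = refl
  table leafˣ   centreʸ = refl
  table leafˣ   leafʸ   = refl
  table centreʸ centreˣ = refl
  table centreʸ leafˣ   = refl
  table centreʸ centreʸ = refl
  table centreʸ leafʸ   = refl
  table leafʸ   centreˣ = refl
  table leafʸ   leafˣ   = refl
  table leafʸ   centreʸ = refl
  table leafʸ   leafʸ   = refl

module DoubleStar {n} (G : Graph n) {x y : Fin n} (x≢y : x ≢ y)
  (hanging : ∀ w → w ≢ x → w ≢ y → LeafOf G w x ⊎ LeafOf G w y) where
  open Basics G

  role : Fin n → Role
  role w = if x ≡F w then centreˣ else if y ≡F w then centreʸ else if adj G x w then leafˣ else leafʸ

  data RoleView (w : Fin n) : Role → Set where
    at-x   : w ≡ x → RoleView w centreˣ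
    at-y   : w ≡ y → RoleView w centreʸ
    leaf-x : w ≢ x → w ≢ y → LeafOf G w x → RoleView w leafˣ
    leaf-y : w ≢ x → w ≢ y → LeafOf G w y → RoleView w leafʸ

  roleView : ∀ w → RoleView w (role w)
  roleView w with x ≟ᶠ w
  ... | yes refl rewrite ≡F-refl x = at-x refl
  ... | no x≢w rewrite ≡F-≢ x≢w with y ≟ᶠ w
  ...   | yes refl rewrite ≡F-refl y = at-y refl
  ...   | no y≢w rewrite ≡F-≢ y≢w with hanging w (≢-sym x≢w) (≢-sym y≢w)
  ...     | inj₁ (wx , only-x) rewrite ~-sym wx = leaf-x (≢-sym x≢w) (≢-sym y≢w) (wx , only-x)
  ...     | inj₂ (wy , only-y) rewrite ¬~⇒≁ (λ xw → x≢y (only-y x (~-sym xw))) =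
              leaf-y (≢-sym x≢w) (≢-sym y≢w) (wy , only-y)

  open Layout G _≟ᴿ_ role public

  role-adj : ∀ i j → adj G i j ≡ roleAdj (adj G x y) (role i) (role j)
  role-adj i j with role i | roleView i | role j | roleView j
  ... | _ | at-x refl                | _ | at-x refl                = irrefl G x
  ... | _ | at-x refl                | _ | at-y refl                = refl
  ... | _ | at-x refl                | _ | leaf-x _ _ (jx , _)      = ~-sym jx
  ... | _ | at-x refl                | _ | leaf-y _ _ (_ , only-y)  = ¬~⇒≁ λ xj → x≢y (only-y x (~-sym xj))
  ... | _ | at-y refl                | _ | at-x refl                = Graph.sym G y x
  ... | _ | at-y refl                | _ | at-y refl                = irrefl G y
  ... | _ | at-y refl                | _ | leaf-x _ _ (_ , only-x)  = ¬~⇒≁ λ yj → x≢y (sym (only-x y (~-sym yj)))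
  ... | _ | at-y refl                | _ | leaf-y _ _ (jy , _)      = ~-sym jy
  ... | _ | leaf-x _ _ (ix , _)      | _ | at-x refl                = ix
  ... | _ | leaf-x _ _ (_ , only-x)  | _ | at-y refl                = ¬~⇒≁ λ iy → x≢y (sym (only-x y iy))
  ... | _ | leaf-x _ _ (_ , only-x)  | _ | leaf-x j≢x _ _           = ¬~⇒≁ λ ij → j≢x (only-x _ ij)
  ... | _ | leaf-x _ _ (_ , only-x)  | _ | leaf-y j≢x _ _           = ¬~⇒≁ λ ij → j≢x (only-x _ ij)
  ... | _ | leaf-y _ _ (_ , only-y)  | _ | at-x refl                = ¬~⇒≁ λ ix → x≢y (only-y x ix)
  ... | _ | leaf-y _ _ (iy , _)      | _ | at-y refl                = iy
  ... | _ | leaf-y _ _ (_ , only-y)  | _ | leaf-x _ j≢y _           = ¬~⇒≁ λ ij → j≢y (only-y _ ij)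
  ... | _ | leaf-y _ _ (_ , only-y)  | _ | leaf-y _ j≢y _           = ¬~⇒≁ λ ij → j≢y (only-y _ ij)

  centre-sizeˣ : classSize centreˣ ≡ 1
  centre-sizeˣ = trans (sum-cong-≗ pointwise) (count-point x)
    where
    pointwise : ∀ w → 𝟙 (does (role w ≟ᴿ centreˣ)) ≡ 𝟙 (x ≡F w)
    pointwise w with role w | roleView w
    ... | _ | at-x refl        = cong 𝟙 (sym (≡F-refl x))
    ... | _ | at-y refl        = cong 𝟙 (sym (≡F-≢ x≢y))
    ... | _ | leaf-x w≢x _ _   = cong 𝟙 (sym (≡F-≢ (≢-sym w≢x)))
    ... | _ | leaf-y w≢x _ _   = cong 𝟙 (sym (≡F-≢ (≢-sym w≢x)))

  centre-sizeʸ : classSize centreʸ ≡ 1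
  centre-sizeʸ = trans (sum-cong-≗ pointwise) (count-point y)
    where
    pointwise : ∀ w → 𝟙 (does (role w ≟ᴿ centreʸ)) ≡ 𝟙 (y ≡F w)
    pointwise w with role w | roleView w
    ... | _ | at-x refl        = cong 𝟙 (sym (≡F-≢ (≢-sym x≢y)))
    ... | _ | at-y refl        = cong 𝟙 (sym (≡F-refl y))
    ... | _ | leaf-x _ w≢y _   = cong 𝟙 (sym (≡F-≢ (≢-sym w≢y)))
    ... | _ | leaf-y _ w≢y _   = cong 𝟙 (sym (≡F-≢ (≢-sym w≢y)))

  leaf-sizeˣ : 𝟙 (adj G x y) + classSize leafˣ ≡ deg G x
  leaf-sizeˣ = sym (trans (sum-zeroAt y (𝟙 ∘ adj G x)) (cong (𝟙 (adj G x y) +_) (sum-cong-≗ pointwise)))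
    where
    pointwise : ∀ w → zeroAt y (𝟙 ∘ adj G x) w ≡ 𝟙 (does (role w ≟ᴿ leafˣ))
    pointwise w with role w | roleView w
    ... | _ | at-x refl               = trans (zeroAt-≢ (𝟙 ∘ adj G x) (≢-sym x≢y)) (cong 𝟙 (irrefl G x))
    ... | _ | at-y refl rewrite ≡F-refl y = refl
    ... | _ | leaf-x _ w≢y (wx , _)    = trans (zeroAt-≢ (𝟙 ∘ adj G x) (≢-sym w≢y)) (cong 𝟙 (~-sym wx))
    ... | _ | leaf-y _ w≢y (_ , only-y) =
      trans (zeroAt-≢ (𝟙 ∘ adj G x) (≢-sym w≢y)) (cong 𝟙 (¬~⇒≁ λ xw → x≢y (only-y x (~-sym xw))))

  leaf-sizeʸ : 𝟙 (adj G x y) + classSize leafʸ ≡ deg G y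
  leaf-sizeʸ = sym (trans (sum-zeroAt x (𝟙 ∘ adj G y))
    (cong₂ _+_ (cong 𝟙 (Graph.sym G y x)) (sum-cong-≗ pointwise)))
    where
    pointwise : ∀ w → zeroAt x (𝟙 ∘ adj G y) w ≡ 𝟙 (does (role w ≟ᴿ leafʸ))
    pointwise w with role w | roleView w
    ... | _ | at-x refl rewrite ≡F-refl x = refl
    ... | _ | at-y refl               = trans (zeroAt-≢ (𝟙 ∘ adj G y) x≢y) (cong 𝟙 (irrefl G y))
    ... | _ | leaf-x w≢x _ (_ , only-x) =
      trans (zeroAt-≢ (𝟙 ∘ adj G y) (≢-sym w≢x)) (cong 𝟙 (¬~⇒≁ λ yw → x≢y (sym (only-x y (~-sym yw)))))
    ... | _ | leaf-y w≢x _ (wy , _)    = trans (zeroAt-≢ (𝟙 ∘ adj G y) (≢-sym w≢x)) (cong 𝟙 (~-sym wy))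

  n≡sizes : n ≡ (classSize centreˣ + classSize leafˣ) + (classSize centreʸ + classSize leafʸ)
  n≡sizes = begin
    n
      ≡⟨ sum-const-1 n ⟨
    ∑[ w < n ] 1
      ≡⟨ sum-cong-≗ one-role ⟨
    ∑[ w < n ] ((in-role centreˣ w + in-role leafˣ w) + (in-role centreʸ w + in-role leafʸ w))
      ≡⟨ ∑-distrib-+ (λ w → in-role centreˣ w + in-role leafˣ w) (λ w → in-role centreʸ w + in-role leafʸ w) ⟩
    sum (λ w → in-role centreˣ w + in-role leafˣ w) + sum (λ w → in-role centreʸ w + in-role leafʸ w)
      ≡⟨ cong₂ _+_ (∑-distrib-+ (in-role centreˣ) (in-role leafˣ)) (∑-distrib-+ (in-role centreʸ) (in-role leafʸ)) ⟩
    (classSize centreˣ + classSize leafˣ) + (classSize centreʸ + classSize leafʸ)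
      ∎
    where
    open ≡-Reasoning
    in-role : Role → Fin n → ℕ
    in-role r w = 𝟙 (inClass r w)
    one-role : ∀ w → (𝟙 (does (role w ≟ᴿ centreˣ)) + 𝟙 (does (role w ≟ᴿ leafˣ)))
                   + (𝟙 (does (role w ≟ᴿ centreʸ)) + 𝟙 (does (role w ≟ᴿ leafʸ))) ≡ 1
    one-role w with role w
    ... | centreˣ = refl
    ... | leafˣ   = refl
    ... | centreʸ = refl
    ... | leafʸ   = refl

  role-adj-with : ∀ {b} → adj G x y ≡ b → ∀ i j → adj G i j ≡ roleAdj b (role i) (role j)
  role-adj-with refl = role-adj

  leavesˣ : ℕ
  leavesˣ = classSize leafˣ

  leavesˣ≥1 : ∀ {a} → x ~ a → a ≢ y → 1 ≤ leavesˣ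
  leavesˣ≥1 {a} xa a≢y = +-cancelˡ-≤ (𝟙 (adj G x y)) 1 leavesˣ (begin
    𝟙 (adj G x y) + 1                     ≡⟨ +-comm (𝟙 (adj G x y)) 1 ⟩
    1 + 𝟙 (adj G x y)                     ≡⟨ cong₂ (λ b c → 𝟙 b + c) xa (+-identityʳ _) ⟨
    𝟙 (adj G x a) + (𝟙 (adj G x y) + 0)   ≤⟨ sum-distinct-≤ (𝟙 ∘ adj G x) ((a≢y ∷ []) ∷ [] ∷ []) ⟩
    deg G x                               ≡⟨ leaf-sizeˣ ⟨
    𝟙 (adj G x y) + leavesˣ               ∎)
    where open ≤-Reasoning

  balanced-sizes : deg G x ≡ deg G y → ∀ c → classSize c ≡ roleCount leavesˣ c
  balanced-sizes _     centreˣ = centre-sizeˣ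
  balanced-sizes _     leafˣ   = refl
  balanced-sizes _     centreʸ = centre-sizeʸ
  balanced-sizes dx≡dy leafʸ   = +-cancelˡ-≡ (𝟙 (adj G x y)) _ _ (trans leaf-sizeʸ (trans (sym dx≡dy) (sym leaf-sizeˣ)))

  n≡2+2leaves : deg G x ≡ deg G y → n ≡ suc leavesˣ + suc leavesˣ
  n≡2+2leaves dx≡dy = trans n≡sizes (cong₂ _+_ (cong₂ _+_ (sizes centreˣ) (sizes leafˣ))
                                               (cong₂ _+_ (sizes centreʸ) (sizes leafʸ)))
    where
    sizes : ∀ c → classSize c ≡ roleCount leavesˣ c
    sizes = balanced-sizes dx≡dy

  twoStar-iso : x ≁ y → deg G x ≡ deg G y → IsoTo G (suc leavesˣ + suc leavesˣ) (twoStarAdj leavesˣ)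
  twoStar-iso x≁y dx≡dy = isoByLayout comb feature id offset id
    (λ c r r<size → fits c r (subst (r <_) (balanced-sizes dx≡dy c) r<size))
    (λ i j → trans (role-adj-with x≁y i j) (table (role i) (role j))) (n≡2+2leaves dx≡dy)
    where open TwoStarLayout leavesˣ

  H4-iso : x ~ y → deg G x ≡ deg G y → IsoTo G (suc leavesˣ + suc leavesˣ) (H4Adj (suc leavesˣ))
  H4-iso x~y dx≡dy = isoByLayout comb feature label offset label-injective
    (λ c r r<size → fits c r (subst (r <_) (balanced-sizes dx≡dy c) r<size))
    (λ i j → trans (role-adj-with x~y i j) (table (role i) (role j))) (n≡2+2leaves dx≡dy)
    where open H4Layout leavesˣ

module Matching {n} (G : Graph n) (noIsolated : NoIsolated G) (deg≤1 : ∀ w → deg G w ≤ 1) where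
  open Basics G

  partner : Fin n → Fin n
  partner w = proj₁ (noIsolated w)

  ~partner : ∀ w → w ~ partner w
  ~partner w = proj₂ (noIsolated w)

  partner-unique : ∀ {w z} → w ~ z → z ≡ partner w
  partner-unique {w} wz = deg-≤1-unique (deg≤1 w) wz (~partner w)

  partner-involutive : ∀ w → partner (partner w) ≡ w
  partner-involutive w = sym (partner-unique (~-sym (~partner w)))

  lower : Fin n → Bool
  lower w = toℕ w <ᵇ toℕ (partner w)

  lower-partner : ∀ w → lower (partner w) ≡ not (lower w)
  lower-partner w rewrite partner-involutive w with <-cmp (toℕ w) (toℕ (partner w))
  ... | tri< w<p _ p≮w rewrite <ᵇ-true w<p | <ᵇ-false p≮w = refl
  ... | tri> w≮p _ p<w rewrite <ᵇ-true p<w | <ᵇ-false w≮p = refl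
  ... | tri≈ _ w≡p _ = ⊥-elim (~-≢ (~partner w) (toℕ-injective w≡p))

  edgeCount : ℕ
  edgeCount = count lower

  n≡edgeCount+edgeCount : n ≡ edgeCount + edgeCount
  n≡edgeCount+edgeCount = trans (sym (count-complement lower)) (cong (edgeCount +_) upper≡lower)
    where
    partner-swap : Permutation n n
    partner-swap = permutation partner partner partner-involutive partner-involutive
    upper≡lower : count (not ∘ lower) ≡ edgeCount
    upper≡lower = trans (∑-permute (𝟙 ∘ not ∘ lower) partner-swap)
                        (sum-cong-≗ (λ w → trans (cong (𝟙 ∘ not) (lower-partner w)) (cong 𝟙 (not-involutive (lower w)))))

  rep : Fin n → Fin n
  rep w = if lower w then w else partner w

  data RepView (w : Fin n) : Set where
    is-lower : lower w ≡ true  → rep w ≡ w         → RepView w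
    is-upper : lower w ≡ false → rep w ≡ partner w → RepView w

  repView : ∀ w → RepView w
  repView w with lower w in eq
  ... | true  = is-lower eq (cong (λ b → if b then w else partner w) eq)
  ... | false = is-upper eq (cong (λ b → if b then w else partner w) eq)

  rep-lower : ∀ w → lower (rep w) ≡ true
  rep-lower w with repView w
  ... | is-lower lw rw = trans (cong lower rw) lw
  ... | is-upper lw rw = trans (cong lower rw) (trans (lower-partner w) (cong not lw))

  rep-partner : ∀ w → rep (partner w) ≡ rep w
  rep-partner w with repView w | repView (partner w)
  ... | is-lower lw rw | is-upper _ rp = trans rp (trans (partner-involutive w) (sym rw))
  ... | is-upper lw rw | is-lower _ rp = trans rp (sym rw)
  ... | is-lower lw _  | is-lower lp _ = ⊥-elim (not-¬ lw (not-injective (trans (sym (lower-partner w)) lp)))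
  ... | is-upper lw _  | is-upper lp _ = ⊥-elim (not-¬ lw (not-injective (trans (sym (lower-partner w)) lp)))

  rep-≡ : ∀ {i j} → rep i ≡ rep j → j ≡ i ⊎ j ≡ partner i
  rep-≡ {i} {j} eq with repView i | repView j
  ... | is-lower _ ri | is-lower _ rj = inj₁ (trans (sym rj) (trans (sym eq) ri))
  ... | is-lower _ ri | is-upper _ rj =
        inj₂ (trans (sym (partner-involutive j)) (cong partner (trans (sym rj) (trans (sym eq) ri))))
  ... | is-upper _ ri | is-lower _ rj = inj₂ (trans (sym rj) (trans (sym eq) ri))
  ... | is-upper _ ri | is-upper _ rj =
        inj₁ (trans (sym (partner-involutive j)) (trans (cong partner (trans (sym rj) (trans (sym eq) ri))) (partner-involutive i)))

  edgeIndex : Fin n → ℕ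
  edgeIndex w = rank lower (rep w)

  -- Edge number e occupies positions 2e (lower end) and 2e + 1 (upper end).
  position : Fin n → ℕ
  position w = 𝟙 (not (lower w)) + 2 * edgeIndex w

  position-< : ∀ w → position w < edgeCount + edgeCount
  position-< w = bit+double-< (not (lower w)) (rank-< lower (rep-lower w))

  ⌊position/2⌋ : ∀ w → ⌊ position w /2⌋ ≡ edgeIndex w
  ⌊position/2⌋ w = ⌊bit+double/2⌋ (not (lower w)) (edgeIndex w)

  edgeIndex-≡ : ∀ {i j} → edgeIndex i ≡ edgeIndex j → j ≡ i ⊎ j ≡ partner i
  edgeIndex-≡ {i} {j} eq = rep-≡ (rank-injective lower (rep-lower i) (rep-lower j) eq)

  edgeIndex-≢ : ∀ {i j} → i ≢ j → ¬ i ~ j → edgeIndex i ≢ edgeIndex j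
  edgeIndex-≢ {i} i≢j i≁j eq with edgeIndex-≡ eq
  ... | inj₁ j≡i  = i≢j (sym j≡i)
  ... | inj₂ refl = i≁j (~partner i)

  position-injective : Injective _≡_ _≡_ position
  position-injective {i} {j} eq with bit+double-injective (not (lower i)) (not (lower j)) (edgeIndex i) (edgeIndex j) eq
  ... | same-side , same-edge with edgeIndex-≡ same-edge
  ...   | inj₁ j≡i = sym j≡i
  ...   | inj₂ refl = ⊥-elim (not-¬ refl (trans (not-injective same-side) (lower-partner i)))

  H1-adj : ∀ i j → adj G i j ≡ (⌊ position i /2⌋ ≡ᵇ ⌊ position j /2⌋) ∧ not (position i ≡ᵇ position j)
  H1-adj i j rewrite ⌊position/2⌋ i | ⌊position/2⌋ j with i ≟ᶠ j
  ... | yes refl rewrite irrefl G i | ≡ᵇ-true {position i} refl = sym (∧-zeroʳ _)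
  ... | no i≢j rewrite ≡ᵇ-false (i≢j ∘ position-injective) with adj G i j in ij
  ...   | true  rewrite ≡ᵇ-true (cong (rank lower) (sym (trans (cong rep (partner-unique ij)) (rep-partner i)))) = refl
  ...   | false rewrite ≡ᵇ-false (edgeIndex-≢ i≢j (≁⇒¬~ ij)) = refl

  matching-iso : IsoTo G (edgeCount + edgeCount) (H1Adj edgeCount)
  matching-iso = isoFromInjection G (H1Adj edgeCount) g n≡edgeCount+edgeCount
    (λ gi≡gj → position-injective (trans (sym (toℕ-g _)) (trans (cong toℕ gi≡gj) (toℕ-g _))))
    (λ i j → trans (H1-adj i j)
                   (cong₂ (λ p q → (⌊ p /2⌋ ≡ᵇ ⌊ q /2⌋) ∧ not (p ≡ᵇ q)) (sym (toℕ-g i)) (sym (toℕ-g j))))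
    where
    g : Fin n → Fin (edgeCount + edgeCount)
    g w = fromℕ< (position-< w)
    toℕ-g : ∀ w → toℕ (g w) ≡ position w
    toℕ-g w = toℕ-fromℕ< (position-< w)

  two-edges : ∀ {u v a b} → u ~ v → a ~ b → u ≢ a → u ≢ b → v ≢ a → v ≢ b → 2 ≤ edgeCount
  two-edges {u} {v} {a} {b} uv ab u≢a u≢b v≢a v≢b =
    subst (_≤ edgeCount) (cong₂ (λ p q → 𝟙 p + (𝟙 q + 0)) (rep-lower u) (rep-lower a))
          (sum-distinct-≤ (𝟙 ∘ lower) ((rep-apart (endpoint uv) (endpoint ab) ∷ []) ∷ [] ∷ []))
    where
    endpoint : ∀ {w z} → w ~ z → rep w ≡ w ⊎ rep w ≡ z
    endpoint {w} wz with repView w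
    ... | is-lower _ rw = inj₁ rw
    ... | is-upper _ rw = inj₂ (trans rw (sym (partner-unique wz)))
    rep-apart : rep u ≡ u ⊎ rep u ≡ v → rep a ≡ a ⊎ rep a ≡ b → rep u ≢ rep a
    rep-apart (inj₁ ru) (inj₁ ra) eq = u≢a (trans (sym ru) (trans eq ra))
    rep-apart (inj₁ ru) (inj₂ ra) eq = u≢b (trans (sym ru) (trans eq ra))
    rep-apart (inj₂ ru) (inj₁ ra) eq = v≢a (trans (sym ru) (trans eq ra))
    rep-apart (inj₂ ru) (inj₂ ra) eq = v≢b (trans (sym ru) (trans eq ra))

-- Excess degrees

module Excess {n} (G : Graph n) (noIsolated : NoIsolated G) where
  open Basics G

  excess : Fin n → ℕ
  excess w = deg G w ∸ 1

  totalExcess : ℕ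
  totalExcess = ∑[ w < n ] excess w

  AllEdgesHeavy : Set
  AllEdgesHeavy = ∀ {u v} → u ~ v → totalExcess ≤ 2 * (excess u + excess v)

  deg≡1+excess : ∀ w → deg G w ≡ suc (excess w)
  deg≡1+excess w = trans (sym (m∸n+n≡m (deg-≥1 (proj₂ (noIsolated w))))) (+-comm (excess w) 1)

  excess≡0-unique : ∀ {w a b} → excess w ≡ 0 → w ~ a → w ~ b → a ≡ b
  excess≡0-unique {w} f≡0 = deg-≤1-unique (subst (_≤ 1) (sym (trans (deg≡1+excess w) (cong suc f≡0))) ≤-refl)

  excess≡0 : ∀ {w a} → (∀ z → w ~ z → z ≡ a) → excess w ≡ 0
  excess≡0 {w} only-a = suc-injective (≤-antisym (subst (_≤ 1) (deg≡1+excess w) (deg-≤1 only-a)) (s≤s z≤n))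

  no-excess⇒deg≤1 : totalExcess ≡ 0 → ∀ w → deg G w ≤ 1
  no-excess⇒deg≤1 F≡0 w = subst (_≤ 1) (sym (trans (deg≡1+excess w) (cong suc (n≤0⇒n≡0 w≤0)))) ≤-refl
    where
    w≤0 : excess w ≤ 0
    w≤0 = subst (excess w ≤_) F≡0 (subst (_≤ totalExcess) (+-identityʳ _) (sum-distinct-≤ excess {w ∷ []} ([] ∷ [])))

  twice-numEdges : 2 * numEdges G ≡ totalExcess + n
  twice-numEdges = begin
    2 * numEdges G               ≡⟨ handshake G ⟨
    ∑[ w < n ] deg G w           ≡⟨ sum-cong-≗ (λ w → trans (deg≡1+excess w) (+-comm 1 (excess w))) ⟩
    ∑[ w < n ] (excess w + 1)    ≡⟨ ∑-distrib-+ excess (λ _ → 1) ⟩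
    totalExcess + ∑[ w < n ] 1   ≡⟨ cong (totalExcess +_) (sum-const-1 n) ⟩
    totalExcess + n              ∎
    where open ≡-Reasoning

  S1size-≤ : ∀ {u v} → edgeᵇ G u v ≡ true → S1size G (u , v) ≤ excess u + excess v
  S1size-≤ {u} {v} uv = +-cancelʳ-≤ 2 _ _ (subst (S1size G (u , v) + 2 ≤_) degrees (S1size-bound G uv))
    where
    degrees : deg G u + deg G v ≡ excess u + excess v + 2
    degrees = trans (cong₂ _+_ (deg≡1+excess u) (deg≡1+excess v))
                    (trans (cong suc (+-suc (excess u) (excess v))) (+-comm 2 (excess u + excess v)))

  oriented : ∀ {u v} → u ~ v → edgeᵇ G u v ≡ true ⊎ edgeᵇ G v u ≡ true
  oriented {u} {v} uv with <-cmp (toℕ u) (toℕ v)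
  ... | tri< u<v _ _ = inj₁ (trans (cong (_∧ adj G u v) (<ᵇ-true u<v)) uv)
  ... | tri> _ _ v<u = inj₂ (trans (cong (_∧ adj G v u) (<ᵇ-true v<u)) (~-sym uv))
  ... | tri≈ _ u≡v _ = ⊥-elim (~-≢ uv (toℕ-injective u≡v))

  no-gap⇒allEdgesHeavy : 2 * numEdges G ≤ 2 * minS1 G + n → AllEdgesHeavy
  no-gap⇒allEdgesHeavy no-gap {u} {v} uv = ≤-trans F≤2min (*-monoʳ-≤ 2 (minS1-≤-excess (oriented uv)))
    where
    F≤2min : totalExcess ≤ 2 * minS1 G
    F≤2min = +-cancelʳ-≤ n _ _ (subst (_≤ 2 * minS1 G + n) twice-numEdges no-gap)
    minS1-≤-excess : edgeᵇ G u v ≡ true ⊎ edgeᵇ G v u ≡ true → minS1 G ≤ excess u + excess v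
    minS1-≤-excess (inj₁ uv) = ≤-trans (minS1-≤ G uv) (S1size-≤ uv)
    minS1-≤-excess (inj₂ vu) =
      ≤-trans (minS1-≤ G vu) (subst (S1size G (v , u) ≤_) (+-comm (excess v) (excess u)) (S1size-≤ vu))

-- Graphs all of whose edges are heavy

OneOf : ∀ {A : Set} → A → A → A → Set
OneOf x y w = w ≡ x ⊎ w ≡ y

oneOf? : ∀ {n} (x y w : Fin n) → Dec (OneOf x y w)
oneOf? x y w = (w ≟ᶠ x) ⊎-dec (w ≟ᶠ y)

Disjoint : ∀ {A : Set} → A → A → A → A → Set
Disjoint x x′ y y′ = ∀ {w} → OneOf x x′ w → OneOf y y′ w → ⊥

module Classification {n} (G : Graph n) (bipartite : Bipartite G) (noIsolated : NoIsolated G) (forest : Forest G)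
  (heavy : Excess.AllEdgesHeavy G noIsolated) where
  open Basics G
  open Excess G noIsolated

  leaf-heavy : ∀ {w x} → w ~ x → excess w ≡ 0 → totalExcess ≤ 2 * excess x
  leaf-heavy {w} {x} wx w-leaf =
    subst (λ e → totalExcess ≤ 2 * e) (trans (cong (excess x +_) w-leaf) (+-identityʳ _)) (heavy (~-sym wx))

  leaf-edge : ∀ {w z} → w ~ z → excess w ≡ 0 → excess z ≡ 0 → totalExcess ≡ 0
  leaf-edge wz w-leaf z-leaf = n≤0⇒n≡0 (subst (λ e → totalExcess ≤ 2 * e) (cong₂ _+_ w-leaf z-leaf) (heavy wz))

  leaf-excess : ∀ {w x y} → LeafOf G w x ⊎ LeafOf G w y → excess w ≡ 0
  leaf-excess = [ excess≡0 ∘ proj₂ , excess≡0 ∘ proj₂ ]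

  balanced : ∀ {x y} → x ≢ y → totalExcess ≤ 2 * excess x → totalExcess ≤ 2 * excess y → excess x ≡ excess y
  balanced {x} {y} x≢y F≤2x F≤2y = proj₁ (squeeze pair F≤2x F≤2y)
    where
    pair : excess x + excess y ≤ totalExcess
    pair = subst (_≤ totalExcess) (cong (excess x +_) (+-identityʳ _)) (sum-distinct-≤ excess ((x≢y ∷ []) ∷ [] ∷ []))

  only-neighbour : ∀ {w c d} → (∀ z → w ~ z → OneOf c d z) → w ~ c → c ~ d → ∀ z → w ~ z → z ≡ c
  only-neighbour nbrs wc cd z wz with nbrs z wz
  ... | inj₁ z≡c  = z≡c
  ... | inj₂ refl = ⊥-elim (bipartite-noTriangle bipartite wc cd wz)

  otherNeighbour? : ∀ w a → Dec (Σ (Fin n) λ z → w ~ z × z ≢ a)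
  otherNeighbour? w a = any? (λ z → (adj G w z ≟ᵇ true) ×-dec ¬? (z ≟ᶠ a))

  another-neighbour : ∀ {w a} → excess w ≢ 0 → w ~ a → Σ (Fin n) λ z → w ~ z × z ≢ a
  another-neighbour {w} {a} w-inner wa with otherNeighbour? w a
  ... | yes found = found
  ... | no none   = ⊥-elim (w-inner (excess≡0 λ z wz → decidable-stable (z ≟ᶠ a) (λ z≢a → none (z , wz , z≢a))))

  double-star : ∀ {x y a} → x ≢ y → (∀ w → w ≢ x → w ≢ y → LeafOf G w x ⊎ LeafOf G w y) →
    excess x ≡ excess y → x ~ a → a ≢ y → Exceptional G
  double-star {x} {y} {a} x≢y hanging fx≡fy xa a≢y = centres (adj G x y) refl
    where
    open DoubleStar G x≢y hanging
    dx≡dy : deg G x ≡ deg G y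
    dx≡dy = trans (deg≡1+excess x) (trans (cong suc fx≡fy) (sym (deg≡1+excess y)))
    centres : ∀ b → adj G x y ≡ b → Exceptional G
    centres true  x~y = inj₂ (inj₂ (suc leavesˣ , s≤s (leavesˣ≥1 xa a≢y) , H4-iso x~y dx≡dy))
    centres false x≁y = inj₂ (inj₁ (leavesˣ , leavesˣ≥1 xa a≢y , twoStar-iso x≁y dx≡dy))

  star-if-pendant : ∀ {u v} → u ~ v → (∀ {i j} → i ~ j → OneOf u v i ⊎ OneOf u v j) →
    ¬ (Σ (Fin n) λ z → u ~ z × z ≢ v) → IsStar G
  star-if-pendant {u} {v} uv meets lonely = Star.isStar G noIsolated v centred u (~-≢ uv)
    where
    only-v : ∀ {z} → u ~ z → z ≡ v
    only-v {z} uz = decidable-stable (z ≟ᶠ v) (λ z≢v → lonely (z , uz , z≢v))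
    centred : ∀ {i j} → i ~ j → i ≡ v ⊎ j ≡ v
    centred ij with meets ij
    ... | inj₁ (inj₁ refl) = inj₂ (only-v ij)
    ... | inj₁ (inj₂ i≡v)  = inj₁ i≡v
    ... | inj₂ (inj₁ refl) = inj₁ (only-v (~-sym ij))
    ... | inj₂ (inj₂ j≡v)  = inj₂ j≡v

  double-star-at-edge : ∀ {u v a b} → u ~ v → (∀ {i j} → i ~ j → OneOf u v i ⊎ OneOf u v j) →
    u ~ a → a ≢ v → v ~ b → b ≢ u → Exceptional G
  double-star-at-edge {u} {v} uv meets ua a≢v vb b≢u =
    double-star (~-≢ uv) hanging (balanced (~-≢ uv) (centre-heavy ua (≢-sym (~-≢ ua)) a≢v)
                                                   (centre-heavy vb b≢u (≢-sym (~-≢ vb)))) ua a≢v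
    where
    nbrs : ∀ {w} → w ≢ u → w ≢ v → ∀ z → w ~ z → OneOf u v z
    nbrs w≢u w≢v z wz with meets wz
    ... | inj₁ (inj₁ w≡u) = ⊥-elim (w≢u w≡u)
    ... | inj₁ (inj₂ w≡v) = ⊥-elim (w≢v w≡v)
    ... | inj₂ z∈uv       = z∈uv
    hanging : ∀ w → w ≢ u → w ≢ v → LeafOf G w u ⊎ LeafOf G w v
    hanging w w≢u w≢v with noIsolated w
    ... | z , wz with nbrs w≢u w≢v z wz
    ...   | inj₁ refl = inj₁ (wz , only-neighbour (nbrs w≢u w≢v) wz uv)
    ...   | inj₂ refl = inj₂ (wz , only-neighbour (λ z′ wz′ → swap (nbrs w≢u w≢v z′ wz′)) wz (~-sym uv))
    centre-heavy : ∀ {c z} → c ~ z → z ≢ u → z ≢ v → totalExcess ≤ 2 * excess c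
    centre-heavy cz z≢u z≢v = leaf-heavy (~-sym cz) (leaf-excess (hanging _ z≢u z≢v))

  all-edges-meet : ∀ {u v} → u ~ v → (∀ {i j} → i ~ j → OneOf u v i ⊎ OneOf u v j) → IsStar G ⊎ Exceptional G
  all-edges-meet {u} {v} uv meets with otherNeighbour? u v | otherNeighbour? v u
  ... | no lonely | _         = inj₁ (star-if-pendant uv meets lonely)
  ... | yes _     | no lonely = inj₁ (star-if-pendant (~-sym uv) (Sum.map swap swap ∘ meets) lonely)
  ... | yes (a , ua , a≢v) | yes (b , vb , b≢u) = inj₂ (double-star-at-edge uv meets ua a≢v vb b≢u)

  module TwoDisjointEdges {x x′ y y′} (xx′ : x ~ x′) (yy′ : y ~ y′) (disjoint : Disjoint x x′ y y′) where

    distinct : Unique (x ∷ x′ ∷ y ∷ y′ ∷ [])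
    distinct = (~-≢ xx′ ∷ disjoint (inj₁ refl) ∘ inj₁ ∷ disjoint (inj₁ refl) ∘ inj₂ ∷ [])
             ∷ (disjoint (inj₂ refl) ∘ inj₁ ∷ disjoint (inj₂ refl) ∘ inj₂ ∷ [])
             ∷ (~-≢ yy′ ∷ []) ∷ [] ∷ []

    sum₄ : ℕ
    sum₄ = (excess x + excess x′) + (excess y + excess y′)

    sum-four : ℕ.sum (map excess (x ∷ x′ ∷ y ∷ y′ ∷ [])) ≡ sum₄
    sum-four = regroup (excess x) (excess x′) (excess y) (excess y′)
      where
      regroup : ∀ a b c d → a + (b + (c + (d + 0))) ≡ (a + b) + (c + d)
      regroup = solve-∀

    halves : excess x + excess x′ ≡ excess y + excess y′ × totalExcess ≡ sum₄
    halves = squeeze (subst (_≤ totalExcess) sum-four (sum-distinct-≤ excess distinct)) (heavy xx′) (heavy yy′)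

    twice-first : totalExcess ≡ 2 * (excess x + excess x′)
    twice-first = trans (proj₂ halves) (cong (excess x + excess x′ +_) (trans (sym (proj₁ halves)) (sym (+-identityʳ _))))

    outside : ∀ w → ¬ OneOf x x′ w → ¬ OneOf y y′ w → excess w ≡ 0
    outside w w∉x w∉y = n≤0⇒n≡0 (+-cancelʳ-≤ sum₄ (excess w) 0 (begin
      excess w + sum₄   ≡⟨ cong (excess w +_) sum-four ⟨
      ℕ.sum (map excess (w ∷ x ∷ x′ ∷ y ∷ y′ ∷ []))
                        ≤⟨ sum-distinct-≤ excess (w∉ ∷ distinct) ⟩
      totalExcess       ≡⟨ proj₂ halves ⟩
      sum₄              ∎))
      where
      open ≤-Reasoning
      w∉ : All (w ≢_) (x ∷ x′ ∷ y ∷ y′ ∷ [])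
      w∉ = (w∉x ∘ inj₁) ∷ (w∉x ∘ inj₂) ∷ (w∉y ∘ inj₁) ∷ (w∉y ∘ inj₂) ∷ []

    x≢other : ∀ {z} → OneOf y y′ z → x ≢ z
    x≢other z∈ refl = disjoint (inj₁ refl) z∈

    x′≢other : ∀ {z} → OneOf y y′ z → x′ ≢ z
    x′≢other z∈ refl = disjoint (inj₂ refl) z∈

    other-adjacent : ∀ {z z′} → OneOf y y′ z → OneOf y y′ z′ → z ≢ z′ → z ~ z′
    other-adjacent (inj₁ refl) (inj₁ refl) z≢z′ = ⊥-elim (z≢z′ refl)
    other-adjacent (inj₁ refl) (inj₂ refl) _    = yy′
    other-adjacent (inj₂ refl) (inj₁ refl) _    = ~-sym yy′
    other-adjacent (inj₂ refl) (inj₂ refl) z≢z′ = ⊥-elim (z≢z′ refl)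

    no-two-crossings : ∀ {z z′} → OneOf y y′ z → OneOf y y′ z′ → x′ ~ z → x ~ z′ → ⊥
    no-two-crossings {z} {z′} z∈ z′∈ x′z xz′ with z ≟ᶠ z′
    ... | yes refl  = bipartite-noTriangle bipartite xx′ x′z xz′
    ... | no  z≢z′ =
      forest-noSquare forest (x≢other z∈) (x′≢other z′∈) xx′ x′z (other-adjacent z∈ z′∈ z≢z′) (~-sym xz′)

    mate-lonely-if-crossing : ∀ {z′} → OneOf y y′ z′ → x ~ z′ → excess x ≢ 0 → ∀ z → x′ ~ z → z ≡ x
    mate-lonely-if-crossing z′∈ xz′ x-inner z x′z with z ≟ᶠ x | oneOf? y y′ z
    ... | yes z≡x | _        = z≡x
    ... | no z≢x  | yes z∈   = ⊥-elim (no-two-crossings z∈ z′∈ x′z xz′)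
    ... | no z≢x  | no z∉    = ⊥-elim (x-inner (twice-sum-≤-twice⇒0 {excess x′} {excess x}
                                 (trans twice-first (cong (2 *_) (+-comm (excess x) (excess x′))))
                                 (leaf-heavy (~-sym x′z) (outside z [ z≢x , ≢-sym (~-≢ x′z) ] z∉))))

    -- A neighbour z′ ≠ x′ of x outside {y, y′} is a leaf, and then F ≤ 2 excess x forces excess x′ = 0.
    mate-is-leaf : excess x ≢ 0 → excess x′ ≡ 0
    mate-is-leaf x-inner with another-neighbour x-inner xx′
    ... | z′ , xz′ , z′≢x′ with oneOf? y y′ z′
    ...   | yes z′∈ = excess≡0 (mate-lonely-if-crossing z′∈ xz′ x-inner)
    ...   | no z′∉  = twice-sum-≤-twice⇒0 {excess x} {excess x′} twice-first
                        (leaf-heavy (~-sym xz′) (outside z′ [ ≢-sym (~-≢ xz′) , z′≢x′ ] z′∉))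

  two-centres : ∀ {x x′ y y′} → x ~ x′ → y ~ y′ → Disjoint x x′ y y′ →
    excess x ≢ 0 → excess y ≢ 0 → totalExcess ≢ 0 → Exceptional G
  two-centres {x} {x′} {y} {y′} xx′ yy′ disjoint x-inner y-inner F≢0 =
    double-star x≢y hanging (balanced x≢y (leaf-heavy (~-sym xx′) x′-leaf) (leaf-heavy (~-sym yy′) y′-leaf))
               xx′ (λ x′≡y → disjoint (inj₂ refl) (inj₁ x′≡y))
    where
    module X = TwoDisjointEdges xx′ yy′ disjoint
    module Y = TwoDisjointEdges yy′ xx′ (λ p q → disjoint q p)
    x≢y : x ≢ y
    x≢y x≡y = disjoint (inj₁ refl) (inj₁ x≡y)
    x′-leaf : excess x′ ≡ 0
    x′-leaf = X.mate-is-leaf x-inner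
    y′-leaf : excess y′ ≡ 0
    y′-leaf = Y.mate-is-leaf y-inner
    leaves : ∀ w → w ≢ x → w ≢ y → excess w ≡ 0
    leaves w w≢x w≢y with w ≟ᶠ x′ | w ≟ᶠ y′
    ... | yes refl | _        = x′-leaf
    ... | no _     | yes refl = y′-leaf
    ... | no w≢x′  | no w≢y′  = X.outside w [ w≢x , w≢x′ ] [ w≢y , w≢y′ ]
    hanging : ∀ w → w ≢ x → w ≢ y → LeafOf G w x ⊎ LeafOf G w y
    hanging w w≢x w≢y with noIsolated w
    ... | z , wz with z ≟ᶠ x | z ≟ᶠ y
    ...   | yes refl | _        = inj₁ (wz , λ z′ wz′ → excess≡0-unique (leaves w w≢x w≢y) wz′ wz)
    ...   | no _     | yes refl = inj₂ (wz , λ z′ wz′ → excess≡0-unique (leaves w w≢x w≢y) wz′ wz)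
    ...   | no z≢x   | no z≢y   = ⊥-elim (F≢0 (leaf-edge wz (leaves w w≢x w≢y) (leaves z z≢x z≢y)))

  inner-endpoint : ∀ {u v} → u ~ v → totalExcess ≢ 0 → excess u ≢ 0 ⊎ excess v ≢ 0
  inner-endpoint {u} uv F≢0 with excess u ≟ 0
  ... | no  u-inner = inj₁ u-inner
  ... | yes u-leaf  = inj₂ (λ v-leaf → F≢0 (leaf-edge uv u-leaf v-leaf))

  disjoint-edges : ∀ {u v a b} → u ~ v → a ~ b → Disjoint u v a b → Exceptional G
  disjoint-edges {u} {v} {a} {b} uv ab disjoint with totalExcess ≟ 0
  ... | yes F≡0 = inj₁ (edgeCount , two-edges uv ab (apart (inj₁ refl) (inj₁ refl)) (apart (inj₁ refl) (inj₂ refl))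
                                         (apart (inj₂ refl) (inj₁ refl)) (apart (inj₂ refl) (inj₂ refl)) , matching-iso)
    where
    apart : ∀ {w z} → OneOf u v w → OneOf a b z → w ≢ z
    apart w∈ z∈ refl = disjoint w∈ z∈
    open Matching G noIsolated (no-excess⇒deg≤1 F≡0)
  ... | no F≢0 with inner-endpoint uv F≢0 | inner-endpoint ab F≢0
  ...   | inj₁ u-inner | inj₁ a-inner = two-centres uv ab disjoint u-inner a-inner F≢0
  ...   | inj₁ u-inner | inj₂ b-inner = two-centres uv (~-sym ab) (λ p q → disjoint p (swap q)) u-inner b-inner F≢0
  ...   | inj₂ v-inner | inj₁ a-inner = two-centres (~-sym uv) ab (λ p q → disjoint (swap p) q) v-inner a-inner F≢0
  ...   | inj₂ v-inner | inj₂ b-inner =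
          two-centres (~-sym uv) (~-sym ab) (λ p q → disjoint (swap p) (swap q)) v-inner b-inner F≢0

  EdgeAvoiding : Fin n → Fin n → Set
  EdgeAvoiding u v = Σ (Fin n) λ a → Σ (Fin n) λ b → a ~ b × ¬ OneOf u v a × ¬ OneOf u v b

  edgeAvoiding? : ∀ u v → Dec (EdgeAvoiding u v)
  edgeAvoiding? u v = any? λ a → any? λ b → (adj G a b ≟ᵇ true) ×-dec ¬? (oneOf? u v a) ×-dec ¬? (oneOf? u v b)

  meets-if-none-avoids : ∀ {u v} → ¬ EdgeAvoiding u v → ∀ {i j} → i ~ j → OneOf u v i ⊎ OneOf u v j
  meets-if-none-avoids {u} {v} none {i} {j} ij with oneOf? u v i | oneOf? u v j
  ... | yes i∈ | _      = inj₁ i∈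
  ... | no _   | yes j∈ = inj₂ j∈
  ... | no i∉  | no j∉  = ⊥-elim (none (i , j , ij , i∉ , j∉))

  star-or-exceptional : ∀ {u v} → u ~ v → IsStar G ⊎ Exceptional G
  star-or-exceptional {u} {v} uv with edgeAvoiding? u v
  ... | yes (a , b , ab , a∉ , b∉) =
    inj₂ (disjoint-edges uv ab λ { w∈ (inj₁ refl) → a∉ w∈ ; w∈ (inj₂ refl) → b∉ w∈ })
  ... | no none = all-edges-meet uv (meets-if-none-avoids none)

lemma3p4 : ∀ {n : ℕ} (H : Graph n) →
    Bipartite H → NoIsolated H → HasEdge H →
    Forest H → ¬ IsStar H → ¬ Exceptional H →
    2 * minS1 H + n < 2 * numEdges H
lemma3p4 {n} H bipartite noIsolated (u , v , uv) forest not-star not-exceptional with 2 * minS1 H + n <? 2 * numEdges H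
... | yes gap   = gap
... | no no-gap = ⊥-elim ([ not-star , not-exceptional ] (star-or-exceptional uv))
  where open Classification H bipartite noIsolated forest (Excess.no-gap⇒allEdgesHeavy H noIsolated (≮⇒≥ no-gap))
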